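{- (1) Let $f$ be a graph invariant with parameters $\alpha,\beta,\gamma,\delta,\varepsilon$ that is proper and well-defined by the conditions (a)–(d) below. Then $\alpha=1$, $\delta=1$ and $\varepsilon=1+\beta+\gamma$. (2) There is a unique proper graph polynomial $U(G;\beta,\gamma)$ that is well-defined by conditions (a)–(d), and it satisfies $Q(G;x,y)=U(G;x(y-1),x)$ and $U(G;\beta,\gamma)=Q\!\left(G;\gamma,\tfrac{\beta}{\gamma}+1\right)$. The conditions are: (a) (multiplicativity) if $G$ is the disjoint union of $G_1$ and $G_2$ then $f(G)=f(G_1)f(G_2)$; (b) (recurrence) for every graph $G$ and every vertex $v$ of $G$, $f(G)=\alpha f(G-v)+\beta f(G-N[v])+\gamma f(G/v)$; (c) $f$ of the null graph $(\emptyset,\emptyset)$ equals $\delta$; (d) $f(E_1)=\varepsilon$, where $E_1$ is the graph with one vertex and no edges.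
   Context: All graphs are finite, simple and undirected. For a graph $G=(V,E)$ and $X\subseteq V$, $G[X]$ is the induced subgraph and $k(H)$ the number of connected components of $H$ (the null graph has $k=0$). The subgraph component polynomial is $Q(G;x,y)=\sum_{X\subseteq V}x^{|X|}y^{k(G[X])}$. For $v\in V$: $G-v$ removes $v$ and its incident edges; $N[v]$ is the closed neighbourhood of $v$ and $G-N[v]$ removes all its vertices; $G/v$ removes $v$ and inserts edges between all pairs of non-adjacent neighbours of $v$. The parameters $\alpha,\beta,\gamma,\delta,\varepsilon$ are taken from a field of characteristic zero (or a ring). The invariant $f$ is "well-defined by (a)–(d)" if the value obtained for every graph by applying (a)–(d) does not depend on the order in which these steps (in particular, the choice of vertex $v$ in (b)) are applied. A graph invariant $f$ is proper if there exist two graphs $G_1,G_2$ with the same number of vertices such that $f(G_1)\neq f(G_2)$. -}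

module Defs where

open import Level using (Level; _⊔_)
open import Data.Bool using (Bool; true; false; not; _∧_; _∨_; if_then_else_)
open import Data.Bool.Properties using (∨-comm; ∧-comm)
open import Data.Nat using (ℕ; zero; suc) renaming (_+_ to _+ℕ_)
open import Data.Fin using (Fin; zero; suc; splitAt)
open import Data.Fin.Properties using (_≟_)
open import Data.List using (List; []; _∷_; length; lookup; filterᵇ; allFin; map; foldr; _++_)
open import Data.Bool.ListAction using (any)
open import Data.Nat using (_<ᵇ_)
open import Data.Fin using (toℕ)
open import Data.Sum using (inj₁; inj₂)
open import Data.Product using (Σ; ∃; _×_; _,_)
open import Function.Bundles using (_↔_; Inverse)
open import Relation.Nullary using (¬_; does; yes; no)
open import Relation.Binary.PropositionalEquality using (_≡_; refl; cong₂)
open import Algebra.Bundles using (CommutativeRing)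

record Field (c ℓ : Level) : Set (Level.suc (c ⊔ ℓ)) where
  field
    commRing : CommutativeRing c ℓ
  open CommutativeRing commRing public
  field
    1≉0   : ¬ (1# ≈ 0#)
    inv   : (x : Carrier) → ¬ (x ≈ 0#) → Carrier
    inv-r : (x : Carrier) (p : ¬ (x ≈ 0#)) → x * inv x p ≈ 1#

module FieldOps {c ℓ} (F : Field c ℓ) where
  open Field F

  ι : ℕ → Carrier
  ι zero    = 0#
  ι (suc n) = 1# + ι n

  pow : Carrier → ℕ → Carrier
  pow x zero    = 1#
  pow x (suc n) = x * pow x n

  sumF : List Carrier → Carrier
  sumF = foldr _+_ 0#

CharZero : ∀ {c ℓ} → Field c ℓ → Set ℓ
CharZero F = ∀ n → ι n ≈ 0# → n ≡ 0
  where open Field F ; open FieldOps F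

record Graph : Set where
  field
    n       : ℕ
    adj     : Fin n → Fin n → Bool
    adj-sym : ∀ i j → adj i j ≡ adj j i
    adj-irr : ∀ i → adj i i ≡ false
open Graph public

eqᵇ : ∀ {m} → Fin m → Fin m → Bool
eqᵇ i j = does (i ≟ j)

eqᵇ-refl : ∀ {m} (i : Fin m) → eqᵇ i i ≡ true
eqᵇ-refl i with i ≟ i
... | yes _ = refl
... | no ¬p = Data.Empty.⊥-elim (¬p refl)
  where import Data.Empty

eqᵇ-sym : ∀ {m} (i j : Fin m) → eqᵇ i j ≡ eqᵇ j i
eqᵇ-sym i j with i ≟ j | j ≟ i
... | yes _ | yes _ = refl
... | no _  | no _  = refl
... | yes p | no ¬q = Data.Empty.⊥-elim (¬q (Relation.Binary.PropositionalEquality.sym p))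
  where import Data.Empty
... | no ¬p | yes q = Data.Empty.⊥-elim (¬p (Relation.Binary.PropositionalEquality.sym q))
  where import Data.Empty

record _≅_ (G H : Graph) : Set where
  field
    bij      : Fin (n G) ↔ Fin (n H)
    preserve : ∀ i j → adj H (Inverse.to bij i) (Inverse.to bij j) ≡ adj G i j

nullGraph : Graph
nullGraph = record { n = 0 ; adj = λ () ; adj-sym = λ () ; adj-irr = λ () }

E₁ : Graph
E₁ = record { n = 1 ; adj = λ _ _ → false ; adj-sym = λ _ _ → refl ; adj-irr = λ _ → refl }

_⊕_ : Graph → Graph → Graph
G₁ ⊕ G₂ = record { n = n G₁ +ℕ n G₂ ; adj = a ; adj-sym = s ; adj-irr = r }
  where
  a : Fin (n G₁ +ℕ n G₂) → Fin (n G₁ +ℕ n G₂) → Bool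
  a i j with splitAt (n G₁) i | splitAt (n G₁) j
  ... | inj₁ x | inj₁ y = adj G₁ x y
  ... | inj₂ x | inj₂ y = adj G₂ x y
  ... | inj₁ _ | inj₂ _ = false
  ... | inj₂ _ | inj₁ _ = false
  s : ∀ i j → a i j ≡ a j i
  s i j with splitAt (n G₁) i | splitAt (n G₁) j
  ... | inj₁ x | inj₁ y = adj-sym G₁ x y
  ... | inj₂ x | inj₂ y = adj-sym G₂ x y
  ... | inj₁ _ | inj₂ _ = refl
  ... | inj₂ _ | inj₁ _ = refl
  r : ∀ i → a i i ≡ false
  r i with splitAt (n G₁) i
  ... | inj₁ x = adj-irr G₁ x
  ... | inj₂ x = adj-irr G₂ x

Subset : ℕ → Set
Subset m = Fin m → Bool

members : ∀ {m} → Subset m → List (Fin m)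
members {m} S = filterᵇ S (allFin m)

size : ∀ {m} → Subset m → ℕ
size S = length (members S)

induced : (G : Graph) → Subset (n G) → Graph
induced G X = record
  { n = size X
  ; adj = λ i j → adj G (lookup (members X) i) (lookup (members X) j)
  ; adj-sym = λ i j → adj-sym G (lookup (members X) i) (lookup (members X) j)
  ; adj-irr = λ i → adj-irr G (lookup (members X) i) }

delete : (G : Graph) → Fin (n G) → Graph
delete G v = induced G (λ u → not (eqᵇ u v))

deleteN : (G : Graph) → Fin (n G) → Graph
deleteN G v = induced G (λ u → not (eqᵇ u v ∨ adj G u v))

completeNbhd : (G : Graph) → Fin (n G) → Graph
completeNbhd G v = record
  { n = n G
  ; adj = a
  ; adj-sym = s
  ; adj-irr = r }
  where
  a : Fin (n G) → Fin (n G) → Bool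
  a i j = (adj G i j ∨ (adj G i v ∧ adj G j v)) ∧ not (eqᵇ i j)
  s : ∀ i j → a i j ≡ a j i
  s i j rewrite adj-sym G i j | ∧-comm (adj G i v) (adj G j v) | eqᵇ-sym i j = refl
  r : ∀ i → a i i ≡ false
  r i rewrite eqᵇ-refl i = ∧-comm (adj G i i ∨ (adj G i v ∧ adj G i v)) false

contract : (G : Graph) → Fin (n G) → Graph
contract G v = delete (completeNbhd G v) v

reach : (G : Graph) → ℕ → Fin (n G) → Fin (n G) → Bool
reach G zero    i j = eqᵇ i j
reach G (suc k) i j = reach G k i j ∨ any (λ u → reach G k i u ∧ adj G u j) (allFin (n G))

connected : (G : Graph) → Fin (n G) → Fin (n G) → Bool
connected G = reach G (n G)

-- k(G): number of connected components, counted as the number of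
-- vertices that are the least vertex of their component.
components : Graph → ℕ
components G =
  length (filterᵇ (λ i → not (any (λ j → connected G j i) (filterᵇ (λ j → toℕ j <ᵇ toℕ i) (allFin (n G))))) (allFin (n G)))

subsets : (m : ℕ) → List (Subset m)
subsets zero    = (λ ()) ∷ []
subsets (suc m) = map (λ S → λ { zero → false ; (suc i) → S i }) (subsets m)
               ++ map (λ S → λ { zero → true ; (suc i) → S i }) (subsets m)

Q : ∀ {c ℓ} (F : Field c ℓ) → Graph → Field.Carrier F → Field.Carrier F → Field.Carrier F
Q F G x y = sumF (map (λ X → pow x (size X) * pow y (components (induced G X))) (subsets (n G)))
  where open Field F ; open FieldOps F

module _ {c ℓ} (F : Field c ℓ) where
  open Field F

  IsGraphInvariant : (Graph → Carrier) → Set ℓ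
  IsGraphInvariant f = ∀ G H → G ≅ H → f G ≈ f H

  IsProper : (Graph → Carrier) → Set ℓ
  IsProper f = Σ Graph λ G₁ → Σ Graph λ G₂ → (n G₁ ≡ n G₂) × ¬ (f G₁ ≈ f G₂)

  WellDefinedBy : (α β γ δ ε : Carrier) → (Graph → Carrier) → Set ℓ
  WellDefinedBy α β γ δ ε f =
      (∀ G₁ G₂ → f (G₁ ⊕ G₂) ≈ f G₁ * f G₂)
    × (∀ G (v : Fin (n G)) →
         f G ≈ α * f (delete G v) + β * f (deleteN G v) + γ * f (contract G v))
    × (f nullGraph ≈ δ)
    × (f E₁ ≈ ε)

module Submission where

-- Theorem 5.10.  Write the subgraph component polynomial as
--   U(G; b, c) = Σ_{X ⊆ V} c^{|X| - k(G[X])} (b + c)^{k(G[X])},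
-- so that Q(G; x, y) = U(G; x(y-1), x) termwise.
-- k(G[X]) is computed as the number of fixed points of any map choosing one
-- vertex per component; this makes it invariant under embeddings and shows
-- how it changes when a vertex v is added to X.  Splitting the subsets X by
-- v ∈ X then yields the vertex recurrence for U with α = 1.
-- The key general fact is that two invariants satisfying the same
-- recurrence and agreeing on graphs without vertices agree everywhere.  It
-- gives multiplicativity of U, the uniqueness in part (2), and, in part (1),
-- β ≠ 0 and ε ≠ 1 (else f would depend only on |V|).  Part (1) then follows
-- from f(∅ ⊕ G) = δ f(G) (so δ = 1), from expanding E₁ (ε = α + β + γ), and
-- from expanding the path P₃ at an end and at its middle vertex, which
-- gives α·β(ε-1) = β(ε-1).

open import Defs
open import Level using (Level)
open import Data.Product using (Σ; _×_; _,_; proj₁; proj₂)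
open import Relation.Nullary using (¬_; yes; no)

open import Data.Nat as ℕ using (ℕ; zero; suc; _≤_; _<_; z≤n; s≤s; _∸_; _<ᵇ_; _≤?_)
import Data.Nat.Properties as ℕP
open import Data.Fin using (Fin; zero; suc; toℕ; _↑ˡ_; _↑ʳ_; splitAt)
import Data.Fin.Properties as FinP
open import Data.Bool using (Bool; true; false; not; _∧_; _∨_; if_then_else_; T; T?)
import Data.Bool.Properties as BoolP
open import Data.List using (List; []; _∷_; map; _++_; allFin; length; lookup; filterᵇ; tabulate)
import Data.List.Properties as ListP
open import Data.List.Relation.Unary.All using (All; []; _∷_)
open import Data.List.Relation.Unary.AllPairs using (AllPairs; []; _∷_)
import Data.List.Relation.Unary.Unique.Propositional.Properties as UniqueP
open import Data.Bool.ListAction using (any)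
open import Data.Maybe using (Maybe; just; nothing; maybe) renaming (map to mapMaybe)
open import Data.Sum using (_⊎_; inj₁; inj₂; [_,_]′)
open import Data.Empty using (⊥; ⊥-elim)
open import Function using (_∘_; id)
open import Function.Bundles using (Inverse; mk↔ₛ′)
open import Relation.Binary.PropositionalEquality as ≡
  using (_≡_; refl; cong; cong₂; subst; subst₂)
open import Relation.Binary.PropositionalEquality.Properties
  using (subst-subst-sym; subst-sym-subst; subst-injective)

bool-ext : ∀ {x y : Bool} → (x ≡ true → y ≡ true) → (y ≡ true → x ≡ true) → x ≡ y
bool-ext {true}  {true}  f g = refl
bool-ext {true}  {false} f g = ≡.sym (f refl)
bool-ext {false} {true}  f g = g refl
bool-ext {false} {false} f g = refl

∧-true : ∀ {x y : Bool} → x ∧ y ≡ true → (x ≡ true) × (y ≡ true)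
∧-true {true} {true} h = refl , refl

∨-true : ∀ {x y : Bool} → x ∨ y ≡ true → (x ≡ true) ⊎ (y ≡ true)
∨-true {true}  h = inj₁ refl
∨-true {false} h = inj₂ h

∨-introʳ : ∀ (x : Bool) {y} → y ≡ true → x ∨ y ≡ true
∨-introʳ x refl = BoolP.∨-zeroʳ x

eqᵇ-true : ∀ {m} (x y : Fin m) → eqᵇ x y ≡ true → x ≡ y
eqᵇ-true x y h with x FinP.≟ y
... | yes p = p
eqᵇ-true x y () | no _

eqᵇ-false : ∀ {m} (x y : Fin m) → ¬ x ≡ y → eqᵇ x y ≡ false
eqᵇ-false x y x≢y with x FinP.≟ y
... | yes p = ⊥-elim (x≢y p)
... | no _  = refl

eqᵇ-injective : ∀ {m k} (f : Fin m → Fin k) → (∀ {x y} → f x ≡ f y → x ≡ y) →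
                ∀ x y → eqᵇ (f x) (f y) ≡ eqᵇ x y
eqᵇ-injective f inj x y = bool-ext
  (λ h → ≡.trans (cong (eqᵇ x) (≡.sym (inj (eqᵇ-true _ _ h)))) (eqᵇ-refl x))
  (λ h → ≡.trans (cong (λ z → eqᵇ (f x) (f z)) (≡.sym (eqᵇ-true x y h))) (eqᵇ-refl (f x)))

count : ∀ {m} → (Fin m → Bool) → ℕ
count {zero}  P = 0
count {suc m} P = if P zero then suc (count (P ∘ suc)) else count (P ∘ suc)

anyᶠ : ∀ {m} → (Fin m → Bool) → Bool
anyᶠ {zero}  P = false
anyᶠ {suc m} P = P zero ∨ anyᶠ (P ∘ suc)

allᶠ : ∀ {m} → (Fin m → Bool) → Bool
allᶠ {zero}  P = true
allᶠ {suc m} P = P zero ∧ allᶠ (P ∘ suc)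

count-cong : ∀ {m} {P Q : Fin m → Bool} → (∀ a → P a ≡ Q a) → count P ≡ count Q
count-cong {zero}  h = refl
count-cong {suc m} {P} {Q} h
  rewrite h zero | count-cong {m} {P ∘ suc} {Q ∘ suc} (h ∘ suc) = refl

anyᶠ-cong : ∀ {m} {P Q : Fin m → Bool} → (∀ a → P a ≡ Q a) → anyᶠ P ≡ anyᶠ Q
anyᶠ-cong {zero}  h = refl
anyᶠ-cong {suc m} {P} {Q} h
  rewrite h zero | anyᶠ-cong {m} {P ∘ suc} {Q ∘ suc} (h ∘ suc) = refl

allᶠ-cong : ∀ {m} {P Q : Fin m → Bool} → (∀ a → P a ≡ Q a) → allᶠ P ≡ allᶠ Q
allᶠ-cong {zero}  h = refl
allᶠ-cong {suc m} {P} {Q} h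
  rewrite h zero | allᶠ-cong {m} {P ∘ suc} {Q ∘ suc} (h ∘ suc) = refl

anyᶠ-witness : ∀ {m} (P : Fin m → Bool) → anyᶠ P ≡ true → Σ (Fin m) (λ i → P i ≡ true)
anyᶠ-witness {suc m} P h with P zero in eq
... | true  = zero , eq
... | false with anyᶠ-witness (P ∘ suc) h
... | i , q = suc i , q

anyᶠ-intro : ∀ {m} (P : Fin m → Bool) i → P i ≡ true → anyᶠ P ≡ true
anyᶠ-intro P zero    h rewrite h = refl
anyᶠ-intro P (suc i) h rewrite anyᶠ-intro (P ∘ suc) i h = BoolP.∨-zeroʳ (P zero)

anyᶠ-none : ∀ {m} (P : Fin m → Bool) → (∀ i → P i ≡ false) → anyᶠ P ≡ false
anyᶠ-none {zero}  P h = refl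
anyᶠ-none {suc m} P h rewrite h zero = anyᶠ-none (P ∘ suc) (h ∘ suc)

allᶠ-elim : ∀ {m} (P : Fin m → Bool) → allᶠ P ≡ true → ∀ i → P i ≡ true
allᶠ-elim P h zero    with P zero
... | true = refl
allᶠ-elim P () zero   | false
allᶠ-elim P h (suc i) with P zero
... | true = allᶠ-elim (P ∘ suc) h i
allᶠ-elim P () (suc i) | false

allᶠ-intro : ∀ {m} (P : Fin m → Bool) → (∀ i → P i ≡ true) → allᶠ P ≡ true
allᶠ-intro {zero}  P h = refl
allᶠ-intro {suc m} P h rewrite h zero = allᶠ-intro (P ∘ suc) (h ∘ suc)

allᶠ-counterexample : ∀ {m} (P : Fin m → Bool) → allᶠ P ≡ false → Σ (Fin m) (λ i → P i ≡ false)
allᶠ-counterexample {suc m} P h with P zero in eq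
... | false = zero , eq
... | true with allᶠ-counterexample (P ∘ suc) h
... | i , q = suc i , q

count-none : ∀ {m} → count {m} (λ _ → false) ≡ 0
count-none {zero}  = refl
count-none {suc m} = count-none {m}

count-all : ∀ {m} → count {m} (λ _ → true) ≡ m
count-all {zero}  = refl
count-all {suc m} = cong suc (count-all {m})

count-≤ : ∀ {m} (P : Fin m → Bool) → count P ≤ m
count-≤ {zero}  P = z≤n
count-≤ {suc m} P with P zero
... | true  = s≤s (count-≤ (P ∘ suc))
... | false = ℕP.m≤n⇒m≤1+n (count-≤ (P ∘ suc))

count-mono : ∀ {m} (P Q : Fin m → Bool) → (∀ a → P a ≡ true → Q a ≡ true) → count P ≤ count Q
count-mono {zero}  P Q h = z≤n
count-mono {suc m} P Q h with P zero in ep | Q zero in eq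
... | true  | true  = s≤s (count-mono (P ∘ suc) (Q ∘ suc) (h ∘ suc))
... | true  | false = ⊥-elim (BoolP.not-¬ (h zero ep) eq)
... | false | true  = ℕP.m≤n⇒m≤1+n (count-mono (P ∘ suc) (Q ∘ suc) (h ∘ suc))
... | false | false = count-mono (P ∘ suc) (Q ∘ suc) (h ∘ suc)

count-strict : ∀ {m} (P Q : Fin m → Bool) → (∀ a → P a ≡ true → Q a ≡ true) →
               ∀ v → Q v ≡ true → P v ≡ false → count P < count Q
count-strict P Q h zero qv pv rewrite qv | pv = s≤s (count-mono (P ∘ suc) (Q ∘ suc) (h ∘ suc))
count-strict P Q h (suc v) qv pv with P zero in ep | Q zero in eq
... | true  | true  = s≤s (count-strict (P ∘ suc) (Q ∘ suc) (h ∘ suc) v qv pv)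
... | true  | false = ⊥-elim (BoolP.not-¬ (h zero ep) eq)
... | false | true  = ℕP.m≤n⇒m≤1+n (count-strict (P ∘ suc) (Q ∘ suc) (h ∘ suc) v qv pv)
... | false | false = count-strict (P ∘ suc) (Q ∘ suc) (h ∘ suc) v qv pv

count-insert : ∀ {m} (P : Fin m → Bool) v → P v ≡ false → count (λ a → P a ∨ eqᵇ a v) ≡ suc (count P)
count-insert P zero pv rewrite pv = cong suc (count-cong (λ a → BoolP.∨-identityʳ (P (suc a))))
count-insert P (suc v) pv with P zero
... | true  = cong suc (count-insert (P ∘ suc) v pv)
... | false = count-insert (P ∘ suc) v pv

image : ∀ {m k} (e : Fin m → Fin k) → (Fin m → Bool) → Fin k → Bool
image e Q a = anyᶠ (λ i → Q i ∧ eqᵇ (e i) a)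

count-image : ∀ {m k} (e : Fin m → Fin k) (Q : Fin m → Bool) →
  (∀ i j → Q i ≡ true → Q j ≡ true → e i ≡ e j → i ≡ j) →
  count (image e Q) ≡ count Q
count-image {zero}  {k} e Q inj = count-none {k}
count-image {suc m} {k} e Q inj with Q zero in q0
... | false = count-image (e ∘ suc) (Q ∘ suc) injˢ
  where injˢ = λ i j qi qj h → FinP.suc-injective (inj (suc i) (suc j) qi qj h)
... | true =
  ≡.trans (count-cong (λ a → ≡.trans (BoolP.∨-comm (eqᵇ (e zero) a) (rest a))
                                     (cong (rest a ∨_) (eqᵇ-sym (e zero) a))))
  (≡.trans (count-insert rest (e zero) fresh)
           (cong suc (count-image (e ∘ suc) (Q ∘ suc) injˢ)))
  where
  injˢ = λ i j qi qj h → FinP.suc-injective (inj (suc i) (suc j) qi qj h)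
  rest : Fin k → Bool
  rest = image (e ∘ suc) (Q ∘ suc)
  fresh : rest (e zero) ≡ false
  fresh with rest (e zero) in eq
  ... | false = refl
  ... | true with anyᶠ-witness _ eq
  ... | i , h with Q (suc i) in qi
  ... | true with inj (suc i) zero qi q0 (eqᵇ-true _ _ h)
  ... | ()

image-member : ∀ {m k} (e : Fin m → Fin k) (Q : Fin m → Bool) i → Q i ≡ true → image e Q (e i) ≡ true
image-member e Q i qi = anyᶠ-intro _ i (cong₂ _∧_ qi (eqᵇ-refl (e i)))

image-preimage : ∀ {m k} (e : Fin m → Fin k) (Q : Fin m → Bool) a →
  image e Q a ≡ true → Σ (Fin m) (λ i → (Q i ≡ true) × (e i ≡ a))
image-preimage e Q a h with anyᶠ-witness _ h
... | i , q with ∧-true {Q i} q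
... | qi , ei = i , qi , eqᵇ-true _ _ ei

module _ {a} {A : Set a} where
  length-filter-tabulate : ∀ {m} (P : A → Bool) (f : Fin m → A) →
                           length (filterᵇ P (tabulate f)) ≡ count (P ∘ f)
  length-filter-tabulate {zero}  P f = refl
  length-filter-tabulate {suc m} P f with P (f zero)
  ... | true  = cong suc (length-filter-tabulate P (f ∘ suc))
  ... | false = length-filter-tabulate P (f ∘ suc)

  any-tabulate : ∀ {m} (P : A → Bool) (f : Fin m → A) → any P (tabulate f) ≡ anyᶠ (P ∘ f)
  any-tabulate {zero}  P f = refl
  any-tabulate {suc m} P f = cong (P (f zero) ∨_) (any-tabulate P (f ∘ suc))

  any-filter : ∀ (P Q : A → Bool) (xs : List A) → any P (filterᵇ Q xs) ≡ any (λ x → Q x ∧ P x) xs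
  any-filter P Q []       = refl
  any-filter P Q (x ∷ xs) with Q x
  ... | true  = cong (P x ∨_) (any-filter P Q xs)
  ... | false = any-filter P Q xs

size≡count : ∀ {m} (S : Subset m) → size S ≡ count S
size≡count S = length-filter-tabulate S id

full : ∀ {m} → Subset m
full _ = true

-- Walk G X a b: a walk from a to b in G all of whose vertices lie in X
-- (i.e. a walk in G[X], phrased without renumbering vertices).
data Walk (G : Graph) (X : Subset (n G)) : Fin (n G) → Fin (n G) → Set where
  stay : ∀ {a} → X a ≡ true → Walk G X a a
  step : ∀ {a b c} → Walk G X a b → adj G b c ≡ true → X c ≡ true → Walk G X a c

module _ {G : Graph} {X : Subset (n G)} where
  walk-start : ∀ {a b} → Walk G X a b → X a ≡ true
  walk-start (stay xa)     = xa
  walk-start (step w _ _)  = walk-start w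

  walk-end : ∀ {a b} → Walk G X a b → X b ≡ true
  walk-end (stay xb)    = xb
  walk-end (step _ _ xb) = xb

  _++ʷ_ : ∀ {a b c} → Walk G X a b → Walk G X b c → Walk G X a c
  w ++ʷ stay _       = w
  w ++ʷ step w' e xc = step (w ++ʷ w') e xc

  edge-walk : ∀ {a b} → X a ≡ true → adj G a b ≡ true → X b ≡ true → Walk G X a b
  edge-walk xa e xb = step (stay xa) e xb

  reverse : ∀ {a b} → Walk G X a b → Walk G X b a
  reverse (stay xa) = stay xa
  reverse (step {b = b} {c = c} w e xc) =
    edge-walk xc (≡.trans (adj-sym G c b) e) (walk-end w) ++ʷ reverse w

walk-mono : ∀ {G : Graph} {X Y : Subset (n G)} → (∀ a → X a ≡ true → Y a ≡ true) →
            ∀ {a b} → Walk G X a b → Walk G Y a b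
walk-mono h (stay xa)     = stay (h _ xa)
walk-mono h (step w e xc) = step (walk-mono h w) e (h _ xc)

module Reachability (G : Graph) where

  reach-walk : ∀ k i j → reach G k i j ≡ true → Walk G full i j
  reach-walk zero i j h rewrite eqᵇ-true i j h = stay refl
  reach-walk (suc k) i j h with ∨-true {reach G k i j} h
  ... | inj₁ h₁ = reach-walk k i j h₁
  ... | inj₂ h₂ with anyᶠ-witness _ (≡.trans (≡.sym (any-tabulate (λ u → reach G k i u ∧ adj G u j) id)) h₂)
  ... | u , q = step (reach-walk k i u (proj₁ (∧-true q))) (proj₂ (∧-true q)) refl

  module Saturation (i : Fin (n G)) where
    S : ℕ → Fin (n G) → Bool
    S k = reach G k i

    next : ℕ → Fin (n G) → Bool
    next k j = anyᶠ (λ u → S k u ∧ adj G u j)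

    S-suc : ∀ k j → S (suc k) j ≡ S k j ∨ next k j
    S-suc k j = cong (S k j ∨_) (any-tabulate (λ u → S k u ∧ adj G u j) id)

    S-step : ∀ k u j → S k u ≡ true → adj G u j ≡ true → S (suc k) j ≡ true
    S-step k u j r e = ≡.trans (S-suc k j) (∨-introʳ (S k j) (anyᶠ-intro _ u (cong₂ _∧_ r e)))

    S-grow : ∀ k j → S k j ≡ true → S (suc k) j ≡ true
    S-grow k j h rewrite h = refl

    S-mono : ∀ k l → k ≤ l → ∀ j → S k j ≡ true → S l j ≡ true
    S-mono k l k≤l j h with ℕP.m≤n⇒∃[o]m+o≡n k≤l
    ... | o , refl = go o
      where
      go : ∀ o → S (k ℕ.+ o) j ≡ true
      go zero    rewrite ℕP.+-identityʳ k = h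
      go (suc o) rewrite ℕP.+-suc k o = S-grow (k ℕ.+ o) j (go o)

    Stable : ℕ → Set
    Stable k = ∀ j → S (suc k) j ≡ S k j

    stable-suc : ∀ k → Stable k → Stable (suc k)
    stable-suc k st j = begin
      S (suc (suc k)) j                  ≡⟨ S-suc (suc k) j ⟩
      S (suc k) j ∨ next (suc k) j       ≡⟨ cong (S (suc k) j ∨_) (anyᶠ-cong (λ u → cong (_∧ adj G u j) (st u))) ⟩
      S (suc k) j ∨ next k j             ≡⟨ cong (_∨ next k j) (S-suc k j) ⟩
      (S k j ∨ next k j) ∨ next k j      ≡⟨ BoolP.∨-assoc (S k j) (next k j) (next k j) ⟩
      S k j ∨ (next k j ∨ next k j)      ≡⟨ cong (S k j ∨_) (BoolP.∨-idem (next k j)) ⟩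
      S k j ∨ next k j                   ≡⟨ ≡.sym (S-suc k j) ⟩
      S (suc k) j                        ∎
      where open ≡.≡-Reasoning

    stable-forever : ∀ k → Stable k → ∀ m j → S (m ℕ.+ k) j ≡ S k j
    stable-forever k st zero    j = refl
    stable-forever k st (suc m) j =
      ≡.trans (stable-suc-+ m j) (stable-forever k st m j)
      where
      stable-suc-+ : ∀ m → Stable (m ℕ.+ k)
      stable-suc-+ zero    = st
      stable-suc-+ (suc m) = stable-suc (m ℕ.+ k) (stable-suc-+ m)

    stable-or-large : ∀ k → (Σ ℕ λ k' → k' < k × Stable k') ⊎ (k < count (S k))
    stable-or-large zero = inj₂ (subst (_< count (S zero)) (count-none {n G})
      (count-strict (λ _ → false) (S zero) (λ _ ()) i (eqᵇ-refl i) refl))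
    stable-or-large (suc k) with stable-or-large k
    ... | inj₁ (k' , k'<k , st) = inj₁ (k' , ℕP.m≤n⇒m≤1+n k'<k , st)
    ... | inj₂ large with allᶠ (λ j → not (S (suc k) j) ∨ S k j) in eq
    ... | true  = inj₁ (k , ℕP.n<1+n k , λ j → bool-ext (shrink (allᶠ-elim _ eq j)) (S-grow k j))
      where
      shrink : ∀ {x y} → not x ∨ y ≡ true → x ≡ true → y ≡ true
      shrink {true} {true} _ _ = refl
    ... | false with allᶠ-counterexample _ eq
    ... | j , q with new q
      where
      new : ∀ {x y} → not x ∨ y ≡ false → (x ≡ true) × (y ≡ false)
      new {true} {false} _ = refl , refl
    ... | in-next , not-in-S = inj₂ (ℕP.<-≤-trans (s≤s large) (count-strict (S k) (S (suc k)) (S-grow k) j in-next not-in-S))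

    stable-early : Σ ℕ λ k' → k' < n G × Stable k'
    stable-early with stable-or-large (n G)
    ... | inj₁ st    = st
    ... | inj₂ large = ⊥-elim (ℕP.<⇒≱ large (count-≤ (S (n G))))

    saturate : ∀ k j → S k j ≡ true → S (n G) j ≡ true
    saturate k j h with k ≤? n G
    ... | yes k≤N = S-mono k (n G) k≤N j h
    ... | no k≰N with stable-early
    ... | k' , k'<N , st =
      S-mono k' (n G) (ℕP.<⇒≤ k'<N) j (≡.trans (≡.sym same) h)
      where
      k'≤k = ℕP.<⇒≤ (ℕP.<-≤-trans k'<N (ℕP.<⇒≤ (ℕP.≰⇒> k≰N)))
      same : S k j ≡ S k' j
      same = ≡.trans (cong (λ z → S z j) (≡.sym (ℕP.m∸n+n≡m k'≤k))) (stable-forever k' st (k ∸ k') j)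

  walk-reach : ∀ {i j} → Walk G full i j → Σ ℕ (λ k → reach G k i j ≡ true)
  walk-reach {i} (stay _) = zero , eqᵇ-refl i
  walk-reach {i} (step w e _) with walk-reach w
  ... | k , r = suc k , Saturation.S-step i k _ _ r e

  connected-walk : ∀ i j → connected G i j ≡ true → Walk G full i j
  connected-walk i j = reach-walk (n G) i j

  walk-connected : ∀ {i j} → Walk G full i j → connected G i j ≡ true
  walk-connected {i} {j} w with walk-reach w
  ... | k , r = Saturation.saturate i k j r

first : ∀ {m} → (Fin m → Bool) → Maybe (Fin m)
first {zero}  P = nothing
first {suc m} P = if P zero then just zero else mapMaybe suc (first (P ∘ suc))

first-cong : ∀ {m} {P Q : Fin m → Bool} → (∀ j → P j ≡ Q j) → first P ≡ first Q
first-cong {zero}  h = refl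
first-cong {suc m} {P} {Q} h rewrite h zero | first-cong {m} {P ∘ suc} {Q ∘ suc} (h ∘ suc) = refl

first-exists : ∀ {m} (P : Fin m → Bool) k → P k ≡ true → Σ (Fin m) (λ k' → first P ≡ just k')
first-exists P zero    h rewrite h = zero , refl
first-exists P (suc k) h with P zero
... | true  = zero , refl
... | false with first-exists (P ∘ suc) k h
... | k' , eq rewrite eq = suc k' , refl

first-spec : ∀ {m} (P : Fin m → Bool) k → first P ≡ just k →
  (P k ≡ true) × (∀ j → toℕ j < toℕ k → P j ≡ false)
first-spec {suc m} P k h with P zero in p0
first-spec {suc m} P .zero refl | true = p0 , λ j ()
... | false with first (P ∘ suc) in e
first-spec {suc m} P .(suc k') refl | false | just k' with first-spec (P ∘ suc) k' e
... | pk , least = pk , λ { zero _ → p0 ; (suc j) (s≤s lt) → least j lt }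

first-none : ∀ {m} (P : Fin m → Bool) → first P ≡ nothing → ∀ j → P j ≡ false
first-none {suc m} P h j with P zero in p0
first-none {suc m} P () j | true
... | false with first (P ∘ suc) in e
first-none {suc m} P refl zero    | false | nothing = p0
first-none {suc m} P refl (suc j) | false | nothing = first-none (P ∘ suc) e j

module _ {A : Set} where
  lookup-filter : ∀ (X : A → Bool) (xs : List A) i → X (lookup (filterᵇ X xs) i) ≡ true
  lookup-filter X (x ∷ xs) i with X x in eq
  lookup-filter X (x ∷ xs) zero    | true = eq
  lookup-filter X (x ∷ xs) (suc i) | true = lookup-filter X xs i
  ... | false = lookup-filter X xs i

  lookup-filter-index : ∀ (X : A → Bool) (xs : List A) k → X (lookup xs k) ≡ true →
    Σ (Fin (length (filterᵇ X xs))) (λ i → lookup (filterᵇ X xs) i ≡ lookup xs k)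
  lookup-filter-index X (x ∷ xs) zero    h rewrite h = zero , refl
  lookup-filter-index X (x ∷ xs) (suc k) h with X x | lookup-filter-index X xs k h
  ... | true  | i , eq = suc i , eq
  ... | false | i , eq = i , eq

  lookup-all : ∀ {P : A → Set} {xs} → All P xs → ∀ k → P (lookup xs k)
  lookup-all (p ∷ _)  zero    = p
  lookup-all (_ ∷ ps) (suc k) = lookup-all ps k

  lookup-injective : ∀ {xs : List A} → AllPairs (λ x y → ¬ x ≡ y) xs →
                     ∀ i j → lookup xs i ≡ lookup xs j → i ≡ j
  lookup-injective (_ ∷ _)   zero    zero    h = refl
  lookup-injective (x∉ ∷ _)  zero    (suc j) h = ⊥-elim (lookup-all x∉ j h)
  lookup-injective (x∉ ∷ _)  (suc i) zero    h = ⊥-elim (lookup-all x∉ i (≡.sym h))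
  lookup-injective (_ ∷ ps)  (suc i) (suc j) h = cong suc (lookup-injective ps i j h)

  lookup-tabulate-onto : ∀ {m} (f : Fin m → A) a → Σ (Fin (length (tabulate f))) (λ k → lookup (tabulate f) k ≡ f a)
  lookup-tabulate-onto f zero    = zero , refl
  lookup-tabulate-onto f (suc a) with lookup-tabulate-onto (f ∘ suc) a
  ... | k , eq = suc k , eq

-- member X i is the i-th element of X; this is the vertex numbering of G[X]
member : ∀ {m} (X : Subset m) → Fin (size X) → Fin m
member X = lookup (members X)

member-in : ∀ {m} (X : Subset m) i → X (member X i) ≡ true
member-in {m} X = lookup-filter X (allFin m)

member-injective : ∀ {m} (X : Subset m) {i j} → member X i ≡ member X j → i ≡ j
member-injective {m} X {i} {j} =
  lookup-injective (UniqueP.filter⁺ (λ x → T? (X x)) (UniqueP.allFin⁺ m)) i j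

member-onto : ∀ {m} (X : Subset m) a → X a ≡ true → Σ (Fin (size X)) (λ i → member X i ≡ a)
member-onto {m} X a xa with lookup-tabulate-onto {m = m} id a
... | k , eq with lookup-filter-index X (allFin m) k (≡.trans (cong X eq) xa)
... | i , eq' = i , ≡.trans eq' eq

-- Embeddings: H is isomorphic to G[X]

record Embedding (H G : Graph) (X : Subset (n G)) : Set where
  field
    e      : Fin (n H) → Fin (n G)
    inj    : ∀ {i j} → e i ≡ e j → i ≡ j
    adj-e  : ∀ i j → adj H i j ≡ adj G (e i) (e j)
    inside : ∀ i → X (e i) ≡ true
    onto   : ∀ a → X a ≡ true → Σ (Fin (n H)) (λ i → e i ≡ a)

induced-embedding : ∀ G X → Embedding (induced G X) G X
induced-embedding G X = record
  { e = member X ; inj = member-injective X ; adj-e = λ _ _ → refl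
  ; inside = member-in X ; onto = member-onto X }

module EmbeddingWalks {H G : Graph} {X : Subset (n G)} (E : Embedding H G X) where
  open Embedding E

  walk-to : ∀ {i j} → Walk H full i j → Walk G X (e i) (e j)
  walk-to {i} (stay _) = stay (inside i)
  walk-to (step {b = b} {c = c} w a _) = step (walk-to w) (≡.trans (≡.sym (adj-e b c)) a) (inside c)

  walk-from : ∀ {a b} → Walk G X a b → ∀ i j → e i ≡ a → e j ≡ b → Walk H full i j
  walk-from (stay _) i j ei ej with inj (≡.trans ei (≡.sym ej))
  ... | refl = stay refl
  walk-from (step {b = b} w ad _) i j ei ej with onto b (walk-end w)
  ... | k , ek = step (walk-from w i k ei ek)
                      (≡.trans (adj-e k j) (subst₂ (λ u v → adj G u v ≡ true) (≡.sym ek) (≡.sym ej) ad)) refl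

  size-embedding : n H ≡ count X
  size-embedding =
    ≡.trans (≡.sym (count-all {n H}))
    (≡.trans (≡.sym (count-image e full (λ _ _ _ _ → inj)))
             (count-cong λ a → bool-ext (into a) (from a)))
    where
    into : ∀ a → image e full a ≡ true → X a ≡ true
    into a h with image-preimage e full a h
    ... | i , _ , refl = inside i
    from : ∀ a → X a ≡ true → image e full a ≡ true
    from a xa with onto a xa
    ... | i , refl = image-member e full i refl

-- Counting components through representatives

record IsRepresentative (G : Graph) (X : Subset (n G)) (r : Fin (n G) → Fin (n G)) : Set where
  field
    stays-in : ∀ a → X a ≡ true → X (r a) ≡ true
    reaches  : ∀ a → X a ≡ true → Walk G X a (r a)
    constant : ∀ {a b} → Walk G X a b → r a ≡ r b

roots : ∀ {m} (X : Subset m) (r : Fin m → Fin m) → Fin m → Bool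
roots X r a = X a ∧ eqᵇ (r a) a

root-elim : ∀ {m} (X : Subset m) r a → roots X r a ≡ true → (X a ≡ true) × (r a ≡ a)
root-elim X r a h with ∧-true {X a} h
... | xa , q = xa , eqᵇ-true _ _ q

root-intro : ∀ {m} (X : Subset m) r a → X a ≡ true → r a ≡ a → roots X r a ≡ true
root-intro X r a xa ra = cong₂ _∧_ xa (≡.trans (cong (λ z → eqᵇ z a) ra) (eqᵇ-refl a))

module _ {G : Graph} {X : Subset (n G)} where
  rep-idempotent : ∀ {r} → IsRepresentative G X r → ∀ a → X a ≡ true → r (r a) ≡ r a
  rep-idempotent isr a xa = ≡.sym (constant (reaches a xa))
    where open IsRepresentative isr

  -- Any two representatives choose the same number of vertices:
  -- r' maps the roots of r bijectively onto the roots of r'.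
  roots-unique : ∀ {r r'} → IsRepresentative G X r → IsRepresentative G X r' →
                 count (roots X r) ≡ count (roots X r')
  roots-unique {r} {r'} isr isr' =
    ≡.trans (≡.sym (count-image r' (roots X r) injective)) (count-cong λ a → bool-ext (into a) (from a))
    where
    open IsRepresentative
    injective : ∀ a b → roots X r a ≡ true → roots X r b ≡ true → r' a ≡ r' b → a ≡ b
    injective a b ha hb eq with root-elim X r a ha | root-elim X r b hb
    ... | xa , ra | xb , rb =
      ≡.trans (≡.sym ra) (≡.trans (constant isr (reaches isr' a xa ++ʷ subst (λ z → Walk G X z b) (≡.sym eq) (reverse (reaches isr' b xb)))) rb)
    into : ∀ a → image r' (roots X r) a ≡ true → roots X r' a ≡ true
    into a h with image-preimage r' (roots X r) a h
    ... | i , hi , refl with root-elim X r i hi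
    ... | xi , _ = root-intro X r' (r' i) (stays-in isr' i xi) (rep-idempotent isr' i xi)
    from : ∀ a → roots X r' a ≡ true → image r' (roots X r) a ≡ true
    from a h with root-elim X r' a h
    ... | xa , r'a = subst (λ z → image r' (roots X r) z ≡ true) (≡.trans r'ra r'a)
                       (image-member r' (roots X r) (r a) (root-intro X r (r a) (stays-in isr a xa) (rep-idempotent isr a xa)))
      where
      r'ra : r' (r a) ≡ r' a
      r'ra = ≡.sym (constant isr' (reaches isr a xa))

-- In any graph, "the least vertex connected to a" is a representative,
-- and its roots are what the definition of components counts.
module Canonical (H : Graph) where
  open Reachability H

  least : Fin (n H) → Fin (n H)
  least a = maybe id a (first (λ j → connected H j a))

  connected-refl : ∀ a → connected H a a ≡ true
  connected-refl a = walk-connected (stay refl)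

  least-found : ∀ a → first (λ j → connected H j a) ≡ just (least a)
  least-found a with first (λ j → connected H j a) in eq
  ... | just k  = refl
  ... | nothing = ⊥-elim (BoolP.not-¬ (connected-refl a) (first-none _ eq a))

  least-spec : ∀ a → (connected H (least a) a ≡ true) × (∀ j → toℕ j < toℕ (least a) → connected H j a ≡ false)
  least-spec a = first-spec _ (least a) (least-found a)

  least-≤ : ∀ a → toℕ (least a) ≤ toℕ a
  least-≤ a with ℕP.≤-<-connex (toℕ (least a)) (toℕ a)
  ... | inj₁ le = le
  ... | inj₂ gt = ⊥-elim (BoolP.not-¬ (connected-refl a) (proj₂ (least-spec a) a gt))

  least-rep : IsRepresentative H full least
  least-rep = record
    { stays-in = λ _ _ → refl
    ; reaches  = λ a _ → reverse (connected-walk _ _ (proj₁ (least-spec a)))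
    ; constant = λ {a} {b} w → just-injective (≡.trans (≡.sym (least-found a))
        (≡.trans (first-cong λ j → bool-ext (λ h → walk-connected (connected-walk j a h ++ʷ w))
                                             (λ h → walk-connected (connected-walk j b h ++ʷ reverse w)))
                 (least-found b))) }
    where
    just-injective : ∀ {x y : Fin (n H)} → just x ≡ just y → x ≡ y
    just-injective refl = refl

  components≡roots : components H ≡ count (roots full least)
  components≡roots =
    ≡.trans (length-filter-tabulate {m = n H} (λ i → not (any (λ j → connected H j i) (filterᵇ (smaller i) (allFin (n H))))) id)
            (count-cong is-least)
    where
    smaller : Fin (n H) → Fin (n H) → Bool
    smaller i j = toℕ j <ᵇ toℕ i
    T→≡ : ∀ {b} → T b → b ≡ true
    T→≡ {true} _ = refl
    none-smaller : ∀ i → least i ≡ i → ∀ j → smaller i j ∧ connected H j i ≡ false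
    none-smaller i eq j with smaller i j in lt
    ... | false = refl
    ... | true  = proj₂ (least-spec i) j (subst (λ z → toℕ j < toℕ z) (≡.sym eq) (ℕP.<ᵇ⇒< _ _ (subst T (≡.sym lt) _)))
    is-least : ∀ i → not (any (λ j → connected H j i) (filterᵇ (smaller i) (allFin (n H)))) ≡ eqᵇ (least i) i
    is-least i rewrite any-filter (λ j → connected H j i) (smaller i) (allFin (n H))
                     | any-tabulate (λ j → smaller i j ∧ connected H j i) id
                     with least i FinP.≟ i
    ... | yes eq rewrite anyᶠ-none (λ j → smaller i j ∧ connected H j i) (none-smaller i eq) = refl
    ... | no ne rewrite anyᶠ-intro (λ j → smaller i j ∧ connected H j i) (least i)
                          (cong₂ _∧_ (T→≡ (ℕP.<⇒<ᵇ (ℕP.≤∧≢⇒< (least-≤ i) (λ h → ne (FinP.toℕ-injective h)))))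
                                     (proj₁ (least-spec i))) = refl

components-by-rep : ∀ {H G X} (E : Embedding H G X) {r} → IsRepresentative G X r →
                    components H ≡ count (roots X r)
components-by-rep {H} {G} {X} E {r} isr =
  ≡.trans (Canonical.components≡roots H)
  (≡.trans (roots-unique (Canonical.least-rep H) pulled-rep)
  (≡.trans (≡.sym (count-image e (roots full rH) (λ _ _ _ _ → inj)))
           (count-cong λ a → bool-ext (into a) (from a))))
  where
  open Embedding E
  open EmbeddingWalks E
  open IsRepresentative isr
  rH : Fin (n H) → Fin (n H)
  rH i = proj₁ (onto (r (e i)) (stays-in (e i) (inside i)))
  e-rH : ∀ i → e (rH i) ≡ r (e i)
  e-rH i = proj₂ (onto (r (e i)) (stays-in (e i) (inside i)))
  pulled-rep : IsRepresentative H full rH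
  pulled-rep = record
    { stays-in = λ _ _ → refl
    ; reaches  = λ i _ → walk-from (reaches (e i) (inside i)) i (rH i) refl (e-rH i)
    ; constant = λ w → inj (≡.trans (e-rH _) (≡.trans (constant (walk-to w)) (≡.sym (e-rH _)))) }
  into : ∀ a → image e (roots full rH) a ≡ true → roots X r a ≡ true
  into a h with image-preimage e (roots full rH) a h
  ... | i , hi , refl = root-intro X r (e i) (inside i) (≡.trans (≡.sym (e-rH i)) (cong e (proj₂ (root-elim full rH i hi))))
  from : ∀ a → roots X r a ≡ true → image e (roots full rH) a ≡ true
  from a h with root-elim X r a h
  ... | xa , ra with onto a xa
  ... | i , refl = image-member e (roots full rH) i
                     (root-intro full rH i refl (inj (≡.trans (e-rH i) ra)))

-- Every vertex set has a representative: transport the canonical one of G[X].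
rep-exists : ∀ G X → Σ (Fin (n G) → Fin (n G)) (IsRepresentative G X)
rep-exists G X = r , record { stays-in = stays ; reaches = walks ; constant = const }
  where
  H = induced G X
  E = induced-embedding G X
  open Embedding E
  open EmbeddingWalks E
  open IsRepresentative (Canonical.least-rep H) renaming (reaches to reachesH; constant to constantH)
  least = Canonical.least H
  index : Fin (n G) → Maybe (Fin (n H))
  index a = first (λ i → eqᵇ (e i) a)
  r : Fin (n G) → Fin (n G)
  r a = maybe (λ i → e (least i)) a (index a)
  index-of : ∀ a → X a ≡ true → Σ (Fin (n H)) λ i → (e i ≡ a) × (r a ≡ e (least i))
  index-of a xa with onto a xa
  ... | i₀ , refl with first-exists (λ i → eqᵇ (e i) (e i₀)) i₀ (eqᵇ-refl (e i₀))
  ... | k , found rewrite found = k , eqᵇ-true (e k) (e i₀) (proj₁ (first-spec _ k found)) , refl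
  stays : ∀ a → X a ≡ true → X (r a) ≡ true
  stays a xa with index-of a xa
  ... | i , _ , ra = ≡.trans (cong X ra) (inside (least i))
  walks : ∀ a → X a ≡ true → Walk G X a (r a)
  walks a xa with index-of a xa
  ... | i , refl , ra = subst (Walk G X (e i)) (≡.sym ra) (walk-to (reachesH i refl))
  const : ∀ {a b} → Walk G X a b → r a ≡ r b
  const {a} {b} w with index-of a (walk-start w) | index-of b (walk-end w)
  ... | i , ei , ra | j , ej , rb = ≡.trans ra (≡.trans (cong e (constantH (walk-from w i j ei ej))) (≡.sym rb))

components-embedding : ∀ {H G X} → Embedding H G X → components H ≡ components (induced G X)
components-embedding {G = G} {X = X} E with rep-exists G X
... | r , isr = ≡.trans (components-by-rep E isr) (≡.sym (components-by-rep (induced-embedding G X) isr))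

components-≤ : ∀ H → components H ≤ n H
components-≤ H = subst (_≤ n H) (≡.sym (length-filter-tabulate {m = n H} _ id)) (count-≤ _)

infix 4 _≗ˢ_
_≗ˢ_ : ∀ {m} → Subset m → Subset m → Set
X ≗ˢ Y = ∀ i → X i ≡ Y i

embedding-resp : ∀ {H G X X'} → Embedding H G X → X ≗ˢ X' → Embedding H G X'
embedding-resp E eq = record
  { e = e ; inj = inj ; adj-e = adj-e ; inside = λ i → ≡.trans (≡.sym (eq (e i))) (inside i)
  ; onto = λ a h → onto a (≡.trans (eq a) h) }
  where open Embedding E

embedding-induced : ∀ {H G X} (E : Embedding H G X) (Y : Subset (n H)) →
                    Embedding (induced H Y) G (image (Embedding.e E) Y)
embedding-induced {H} {G} {X} E Y = record
  { e = e ∘ member Y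
  ; inj = member-injective Y ∘ inj
  ; adj-e = λ i j → adj-e (member Y i) (member Y j)
  ; inside = λ i → image-member e Y (member Y i) (member-in Y i)
  ; onto = preimage }
  where
  open Embedding E
  preimage : ∀ a → image e Y a ≡ true → Σ (Fin (size Y)) (λ i → e (member Y i) ≡ a)
  preimage a h with image-preimage e Y a h
  ... | k , yk , refl with member-onto Y k yk
  ... | j , refl = j , refl

embedding-iso : ∀ {G H} → G ≅ H → Embedding G H full
embedding-iso {G} {H} iso = record
  { e = to
  ; inj = λ {i} {j} h → ≡.trans (≡.sym (strictlyInverseʳ i)) (≡.trans (cong from h) (strictlyInverseʳ j))
  ; adj-e = λ i j → ≡.sym (_≅_.preserve iso i j)
  ; inside = λ _ → refl
  ; onto = λ a _ → from a , strictlyInverseˡ a }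
  where open Inverse (_≅_.bij iso)

-- How k(G[X]) changes when a vertex v is added to X

insert : ∀ {m} → Fin m → Subset m → Subset m
insert v Y a = Y a ∨ eqᵇ a v

module LocalComponents (G : Graph) (v : Fin (n G)) where

  G' : Graph
  G' = completeNbhd G v

  decide : ∀ {m} (a b : Fin m) → (a ≡ b) ⊎ ¬ a ≡ b
  decide a b with a FinP.≟ b
  ... | yes p = inj₁ p
  ... | no p  = inj₂ p

  no-loop : ∀ {x y} → adj G x y ≡ true → ¬ x ≡ y
  no-loop {x} h refl = BoolP.not-¬ h (adj-irr G x)

  module _ (Y : Subset (n G)) where
    insert-old : ∀ {a} → insert v Y a ≡ true → ¬ a ≡ v → Y a ≡ true
    insert-old {a} h ne rewrite eqᵇ-false a v ne | BoolP.∨-identityʳ (Y a) = h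

    insert-⊇ : ∀ a → Y a ≡ true → insert v Y a ≡ true
    insert-⊇ a ya rewrite ya = refl

    insert-new : insert v Y v ≡ true
    insert-new rewrite eqᵇ-refl v = BoolP.∨-zeroʳ (Y v)

    outside : Y v ≡ false → ∀ {a} → Y a ≡ true → ¬ a ≡ v
    outside yv ya refl with ≡.trans (≡.sym yv) ya
    ... | ()

    size-insert : Y v ≡ false → size (insert v Y) ≡ suc (size Y)
    size-insert yv = ≡.trans (size≡count (insert v Y)) (≡.trans (count-insert Y v yv) (cong suc (≡.sym (size≡count Y))))

  G'-away : ∀ x y → adj G x v ≡ false → adj G' x y ≡ adj G x y
  G'-away x y hx rewrite hx | BoolP.∨-identityʳ (adj G x y) with decide x y
  ... | inj₁ refl rewrite adj-irr G x = refl
  ... | inj₂ ne rewrite eqᵇ-false x y ne = BoolP.∧-identityʳ (adj G x y)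

  G'-neighbours : ∀ x y → ¬ x ≡ y → adj G x v ≡ true → adj G y v ≡ true → adj G' x y ≡ true
  G'-neighbours x y ne hx hy rewrite hx | hy | eqᵇ-false x y ne = cong (_∧ true) (BoolP.∨-zeroʳ (adj G x y))

  G'-⊇ : ∀ x y → adj G x y ≡ true → adj G' x y ≡ true
  G'-⊇ x y h rewrite h | eqᵇ-false x y (no-loop h) = refl

  G'-edge : ∀ x y → adj G' x y ≡ true → (adj G x y ≡ true) ⊎ ((adj G x v ≡ true) × (adj G y v ≡ true))
  G'-edge x y h with ∧-true {adj G x y ∨ (adj G x v ∧ adj G y v)} h
  ... | h₁ , _ with ∨-true {adj G x y} h₁
  ... | inj₁ q = inj₁ q
  ... | inj₂ q = inj₂ (∧-true q)

  module Isolated (Y : Subset (n G)) (yv : Y v ≡ false) (away : ∀ a → Y a ≡ true → adj G a v ≡ false) where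
    private
      X = insert v Y
      rY = proj₁ (rep-exists G Y)
      isrY = proj₂ (rep-exists G Y)
      open module RY = IsRepresentative isrY

    split : ∀ {a b} → Walk G X a b → ((a ≡ v) × (b ≡ v)) ⊎ Walk G Y a b
    split (stay {a} xa) with decide a v
    ... | inj₁ eq = inj₁ (eq , eq)
    ... | inj₂ ne = inj₂ (stay (insert-old Y xa ne))
    split (step {b = b} {c = c} w ad xc) with split w | decide c v
    ... | inj₁ (_ , refl) | inj₁ refl = ⊥-elim (no-loop ad refl)
    ... | inj₁ (_ , refl) | inj₂ nc   = ⊥-elim (BoolP.not-¬ (≡.trans (adj-sym G c v) ad) (away c (insert-old Y xc nc)))
    ... | inj₂ w'         | inj₁ refl = ⊥-elim (BoolP.not-¬ ad (away b (walk-end w')))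
    ... | inj₂ w'         | inj₂ nc   = inj₂ (step w' ad (insert-old Y xc nc))

    r : Fin (n G) → Fin (n G)
    r a = if eqᵇ a v then v else rY a

    r-v : r v ≡ v
    r-v rewrite eqᵇ-refl v = refl

    r-old : ∀ {a} → ¬ a ≡ v → r a ≡ rY a
    r-old {a} ne rewrite eqᵇ-false a v ne = refl

    isr : IsRepresentative G X r
    isr = record { stays-in = stays ; reaches = walks ; constant = const }
      where
      stays : ∀ a → X a ≡ true → X (r a) ≡ true
      stays a xa with decide a v
      ... | inj₁ refl rewrite r-v = xa
      ... | inj₂ ne rewrite r-old ne = insert-⊇ Y _ (RY.stays-in a (insert-old Y xa ne))
      walks : ∀ a → X a ≡ true → Walk G X a (r a)
      walks a xa with decide a v
      ... | inj₁ refl rewrite r-v = stay xa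
      ... | inj₂ ne rewrite r-old ne = walk-mono (insert-⊇ Y) (RY.reaches a (insert-old Y xa ne))
      const : ∀ {a b} → Walk G X a b → r a ≡ r b
      const w with split w
      ... | inj₁ (refl , refl) = refl
      ... | inj₂ w' rewrite r-old (outside Y yv (walk-start w')) | r-old (outside Y yv (walk-end w')) = RY.constant w'

    components-insert : components (induced G X) ≡ suc (components (induced G Y))
    components-insert =
      ≡.trans (components-by-rep (induced-embedding G X) isr)
      (≡.trans (count-cong new-root)
      (≡.trans (count-insert (roots Y rY) v v-not-root)
               (cong suc (≡.sym (components-by-rep (induced-embedding G Y) isrY)))))
      where
      v-not-root : roots Y rY v ≡ false
      v-not-root rewrite yv = refl
      new-root : ∀ a → roots X r a ≡ roots Y rY a ∨ eqᵇ a v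
      new-root a with decide a v
      ... | inj₁ refl rewrite r-v | eqᵇ-refl v | yv = refl
      ... | inj₂ ne rewrite r-old ne | eqᵇ-false a v ne | BoolP.∨-identityʳ (Y a)
                          | BoolP.∨-identityʳ (Y a ∧ eqᵇ (rY a) a) = refl

    components-completeNbhd : components (induced G' Y) ≡ components (induced G Y)
    components-completeNbhd = components-embedding G'[Y]↪G
      where
      G'[Y]↪G : Embedding (induced G' Y) G Y
      G'[Y]↪G = record
        { e = member Y ; inj = member-injective Y
        ; adj-e = λ i j → G'-away (member Y i) (member Y j) (away _ (member-in Y i))
        ; inside = member-in Y ; onto = member-onto Y }

  -- If some w ∈ Y is adjacent to v, then the components of G[Y + v] are
  -- those of G'[Y]: v merges with w, and walks through v become edges of G'.
  module Attached (Y : Subset (n G)) (yv : Y v ≡ false) (w : Fin (n G)) (yw : Y w ≡ true) (wv : adj G w v ≡ true) where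
    private
      X = insert v Y
      rY = proj₁ (rep-exists G' Y)
      isrY = proj₂ (rep-exists G' Y)
      open module RY = IsRepresentative isrY

    φ : Fin (n G) → Fin (n G)
    φ a = if eqᵇ a v then w else a

    φ-v : φ v ≡ w
    φ-v rewrite eqᵇ-refl v = refl

    φ-old : ∀ {a} → ¬ a ≡ v → φ a ≡ a
    φ-old {a} ne rewrite eqᵇ-false a v ne = refl

    φ-in : ∀ a → X a ≡ true → Y (φ a) ≡ true
    φ-in a xa with decide a v
    ... | inj₁ refl rewrite φ-v = yw
    ... | inj₂ ne rewrite φ-old ne = insert-old Y xa ne

    to-w : ∀ {a b} → Walk G' Y a b → adj G b v ≡ true → Walk G' Y a w
    to-w {b = b} walk bv with decide b w
    ... | inj₁ refl = walk
    ... | inj₂ ne   = step walk (G'-neighbours b w ne bv wv) yw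

    walk-φ : ∀ {a b} → Walk G X a b → Walk G' Y (φ a) (φ b)
    walk-φ (stay {a} xa) = stay (φ-in a xa)
    walk-φ (step {b = b} {c = c} walk ad xc) with walk-φ walk | decide b v | decide c v
    ... | q | inj₁ refl | inj₁ refl = ⊥-elim (no-loop ad refl)
    ... | q | inj₂ nb   | inj₂ nc rewrite φ-old nb | φ-old nc = step q (G'-⊇ b c ad) (insert-old Y xc nc)
    ... | q | inj₂ nb   | inj₁ refl rewrite φ-old nb | φ-v = to-w q ad
    ... | q | inj₁ refl | inj₂ nc rewrite φ-v | φ-old nc with decide c w
    ...   | inj₁ refl = q
    ...   | inj₂ ncw  = step q (G'-neighbours w c (λ h → ncw (≡.sym h)) wv (≡.trans (adj-sym G c v) ad)) (insert-old Y xc nc)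

    walk-unφ : ∀ {a b} → Walk G' Y a b → Walk G X a b
    walk-unφ (stay ya) = stay (insert-⊇ Y _ ya)
    walk-unφ (step {b = b} {c = c} walk ad yc) with G'-edge b c ad
    ... | inj₁ h = step (walk-unφ walk) h (insert-⊇ Y c yc)
    ... | inj₂ (bv , cv) = step (step (walk-unφ walk) bv (insert-new Y)) (≡.trans (adj-sym G v c) cv) (insert-⊇ Y c yc)

    r : Fin (n G) → Fin (n G)
    r a = rY (φ a)

    isr : IsRepresentative G X r
    isr = record { stays-in = stays ; reaches = walks ; constant = λ walk → RY.constant (walk-φ walk) }
      where
      stays : ∀ a → X a ≡ true → X (r a) ≡ true
      stays a xa = insert-⊇ Y _ (RY.stays-in (φ a) (φ-in a xa))
      walks : ∀ a → X a ≡ true → Walk G X a (r a)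
      walks a xa with decide a v
      ... | inj₁ refl rewrite φ-v = edge-walk xa (≡.trans (adj-sym G v w) wv) (insert-⊇ Y w yw) ++ʷ walk-unφ (RY.reaches w yw)
      ... | inj₂ ne rewrite φ-old ne = walk-unφ (RY.reaches a (insert-old Y xa ne))

    components-insert : components (induced G X) ≡ components (induced G' Y)
    components-insert =
      ≡.trans (components-by-rep (induced-embedding G X) isr)
      (≡.trans (count-cong same-roots)
               (≡.sym (components-by-rep (induced-embedding G' Y) isrY)))
      where
      same-roots : ∀ a → roots X r a ≡ roots Y rY a
      same-roots a with decide a v
      ... | inj₁ refl rewrite φ-v | yv | eqᵇ-refl v
                            | eqᵇ-false (rY w) v (outside Y yv (RY.stays-in w yw)) = refl
      ... | inj₂ ne rewrite φ-old ne | eqᵇ-false a v ne | BoolP.∨-identityʳ (Y a) = refl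

delete-size : ∀ G v → suc (n (delete G v)) ≡ n G
delete-size G v =
  ≡.trans (cong suc (size≡count (λ u → not (eqᵇ u v))))
  (≡.trans (≡.sym (count-insert (λ u → not (eqᵇ u v)) v (cong not (eqᵇ-refl v))))
  (≡.trans (count-cong (λ a → BoolP.∨-inverseˡ (eqᵇ a v))) (count-all {n G})))

contract-size : ∀ G v → suc (n (contract G v)) ≡ n G
contract-size G v = delete-size (completeNbhd G v) v

deleteN-size : ∀ G v → n (deleteN G v) ≤ n (delete G v)
deleteN-size G v =
  subst₂ _≤_ (≡.sym (size≡count (λ u → not (eqᵇ u v ∨ adj G u v)))) (≡.sym (size≡count (λ u → not (eqᵇ u v))))
    (count-mono _ _ (λ a → not-∨ (eqᵇ a v) (adj G a v)))
  where
  not-∨ : ∀ x y → not (x ∨ y) ≡ true → not x ≡ true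
  not-∨ false y h = refl

empty-or-vertex : ∀ G → (n G ≡ 0) ⊎ Fin (n G)
empty-or-vertex G with n G
... | zero  = inj₁ refl
... | suc m = inj₂ zero

data Side (m k : ℕ) : Fin (m ℕ.+ k) → Set where
  left  : (x : Fin m) → Side m k (x ↑ˡ k)
  right : (y : Fin k) → Side m k (m ↑ʳ y)

side : ∀ m k (i : Fin (m ℕ.+ k)) → Side m k i
side m k i with splitAt m i in eq
... | inj₁ x = subst (Side m k) (FinP.splitAt⁻¹-↑ˡ eq) (left x)
... | inj₂ y = subst (Side m k) (FinP.splitAt⁻¹-↑ʳ eq) (right y)

left≢right : ∀ {m k} (x : Fin m) (y : Fin k) → ¬ x ↑ˡ k ≡ m ↑ʳ y
left≢right {m} {k} x y eq
  with ≡.trans (≡.sym (FinP.splitAt-↑ˡ m x k)) (≡.trans (cong (splitAt m) eq) (FinP.splitAt-↑ʳ m k y))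
... | ()

module _ (A B : Graph) where
  adj-ll : ∀ x y → adj (A ⊕ B) (x ↑ˡ n B) (y ↑ˡ n B) ≡ adj A x y
  adj-ll x y rewrite FinP.splitAt-↑ˡ (n A) x (n B) | FinP.splitAt-↑ˡ (n A) y (n B) = refl

  adj-rr : ∀ x y → adj (A ⊕ B) (n A ↑ʳ x) (n A ↑ʳ y) ≡ adj B x y
  adj-rr x y rewrite FinP.splitAt-↑ʳ (n A) (n B) x | FinP.splitAt-↑ʳ (n A) (n B) y = refl

  adj-lr : ∀ x y → adj (A ⊕ B) (x ↑ˡ n B) (n A ↑ʳ y) ≡ false
  adj-lr x y rewrite FinP.splitAt-↑ˡ (n A) x (n B) | FinP.splitAt-↑ʳ (n A) (n B) y = refl

  adj-rl : ∀ x y → adj (A ⊕ B) (n A ↑ʳ x) (y ↑ˡ n B) ≡ false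
  adj-rl x y rewrite FinP.splitAt-↑ˡ (n A) y (n B) | FinP.splitAt-↑ʳ (n A) (n B) x = refl

  withRight : Subset (n A) → Subset (n A ℕ.+ n B)
  withRight X a = [ X , (λ _ → true) ]′ (splitAt (n A) a)

  withRight-l : ∀ X x → withRight X (x ↑ˡ n B) ≡ X x
  withRight-l X x rewrite FinP.splitAt-↑ˡ (n A) x (n B) = refl

  withRight-r : ∀ X y → withRight X (n A ↑ʳ y) ≡ true
  withRight-r X y rewrite FinP.splitAt-↑ʳ (n A) (n B) y = refl

eqᵇ-lr : ∀ {m k} (x : Fin m) (y : Fin k) → eqᵇ (x ↑ˡ k) (m ↑ʳ y) ≡ false
eqᵇ-lr x y = eqᵇ-false _ _ (left≢right x y)

eqᵇ-rl : ∀ {m k} (y : Fin k) (x : Fin m) → eqᵇ (m ↑ʳ y) (x ↑ˡ k) ≡ false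
eqᵇ-rl x y = eqᵇ-false _ _ (λ h → left≢right y x (≡.sym h))

embedding-⊕ : ∀ {H A X} (E : Embedding H A X) (B : Graph) → Embedding (H ⊕ B) (A ⊕ B) (withRight A B X)
embedding-⊕ {H} {A} {X} E B = record { e = e' ; inj = inj' ; adj-e = adj-e' ; inside = inside' ; onto = onto' }
  where
  open Embedding E
  e' : Fin (n H ℕ.+ n B) → Fin (n A ℕ.+ n B)
  e' i = [ (λ x → e x ↑ˡ n B) , (λ y → n A ↑ʳ y) ]′ (splitAt (n H) i)
  e'-l : ∀ x → e' (x ↑ˡ n B) ≡ e x ↑ˡ n B
  e'-l x rewrite FinP.splitAt-↑ˡ (n H) x (n B) = refl
  e'-r : ∀ y → e' (n H ↑ʳ y) ≡ n A ↑ʳ y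
  e'-r y rewrite FinP.splitAt-↑ʳ (n H) (n B) y = refl
  inj' : ∀ {i j} → e' i ≡ e' j → i ≡ j
  inj' {i} {j} h with side (n H) (n B) i | side (n H) (n B) j
  ... | left x  | left y  = cong (_↑ˡ n B) (inj (FinP.↑ˡ-injective (n B) _ _ (≡.trans (≡.sym (e'-l x)) (≡.trans h (e'-l y)))))
  ... | right x | right y = cong (n H ↑ʳ_) (FinP.↑ʳ-injective (n A) _ _ (≡.trans (≡.sym (e'-r x)) (≡.trans h (e'-r y))))
  ... | left x  | right y = ⊥-elim (left≢right _ _ (≡.trans (≡.sym (e'-l x)) (≡.trans h (e'-r y))))
  ... | right x | left y  = ⊥-elim (left≢right _ _ (≡.trans (≡.sym (e'-l y)) (≡.trans (≡.sym h) (e'-r x))))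
  adj-e' : ∀ i j → adj (H ⊕ B) i j ≡ adj (A ⊕ B) (e' i) (e' j)
  adj-e' i j with side (n H) (n B) i | side (n H) (n B) j
  ... | left x  | left y  rewrite e'-l x | e'-l y | adj-ll H B x y | adj-ll A B (e x) (e y) = adj-e x y
  ... | right x | right y rewrite e'-r x | e'-r y | adj-rr H B x y | adj-rr A B x y = refl
  ... | left x  | right y rewrite e'-l x | e'-r y | adj-lr H B x y | adj-lr A B (e x) y = refl
  ... | right x | left y  rewrite e'-r x | e'-l y | adj-rl H B x y | adj-rl A B x (e y) = refl
  inside' : ∀ i → withRight A B X (e' i) ≡ true
  inside' i with side (n H) (n B) i
  ... | left x  rewrite e'-l x | withRight-l A B X (e x) = inside x
  ... | right y rewrite e'-r y | withRight-r A B X y = refl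
  onto' : ∀ a → withRight A B X a ≡ true → Σ (Fin (n H ℕ.+ n B)) (λ i → e' i ≡ a)
  onto' a h with side (n A) (n B) a
  ... | left x with onto x (≡.trans (≡.sym (withRight-l A B X x)) h)
  ...   | i , refl = (i ↑ˡ n B) , e'-l i
  onto' a h | right y = (n H ↑ʳ y) , e'-r y

embedding-right : ∀ A B → n A ≡ 0 → Embedding B (A ⊕ B) full
embedding-right A B empty = record
  { e = n A ↑ʳ_ ; inj = λ h → FinP.↑ʳ-injective (n A) _ _ h
  ; adj-e = λ i j → ≡.sym (adj-rr A B i j) ; inside = λ _ → refl ; onto = λ a _ → from-right a }
  where
  from-right : ∀ a → Σ (Fin (n B)) (λ y → n A ↑ʳ y ≡ a)
  from-right a with side (n A) (n B) a
  ... | left x  = ⊥-elim (no-vertex (subst Fin empty x))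
    where no-vertex : Fin 0 → ⊥
          no-vertex ()
  ... | right y = y , refl

module DeleteInSum (G B : Graph) (v : Fin (n G)) where
  v' : Fin (n (G ⊕ B))
  v' = v ↑ˡ n B

  eqᵇ-l : ∀ (x y : Fin (n G)) → eqᵇ (x ↑ˡ n B) (y ↑ˡ n B) ≡ eqᵇ x y
  eqᵇ-l = eqᵇ-injective (_↑ˡ n B) (λ {x} {y} → FinP.↑ˡ-injective (n B) x y)

  eqᵇ-r : ∀ (x y : Fin (n B)) → eqᵇ (n G ↑ʳ x) (n G ↑ʳ y) ≡ eqᵇ x y
  eqᵇ-r = eqᵇ-injective (n G ↑ʳ_) (λ {x} {y} → FinP.↑ʳ-injective (n G) x y)

  delete-set : (λ a → not (eqᵇ a v')) ≗ˢ withRight G B (λ u → not (eqᵇ u v))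
  delete-set a with side (n G) (n B) a
  ... | left x  = ≡.trans (cong not (eqᵇ-l x v)) (≡.sym (withRight-l G B (λ u → not (eqᵇ u v)) x))
  ... | right y = ≡.trans (cong not (eqᵇ-rl {n G} {n B} y v)) (≡.sym (withRight-r G B (λ u → not (eqᵇ u v)) y))

  deleteN-set : (λ a → not (eqᵇ a v' ∨ adj (G ⊕ B) a v')) ≗ˢ withRight G B (λ u → not (eqᵇ u v ∨ adj G u v))
  deleteN-set a with side (n G) (n B) a
  ... | left x  = ≡.trans (cong₂ (λ p q → not (p ∨ q)) (eqᵇ-l x v) (adj-ll G B x v))
                          (≡.sym (withRight-l G B (λ u → not (eqᵇ u v ∨ adj G u v)) x))
  ... | right y = ≡.trans (cong₂ (λ p q → not (p ∨ q)) (eqᵇ-rl {n G} {n B} y v) (adj-rl G B y v))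
                          (≡.sym (withRight-r G B (λ u → not (eqᵇ u v ∨ adj G u v)) y))

  private
    G' = completeNbhd G v
    shape : ∀ {p p' q q' r r' s s' : Bool} → p ≡ p' → q ≡ q' → r ≡ r' → s ≡ s' →
            (p ∨ (q ∧ r)) ∧ not s ≡ (p' ∨ (q' ∧ r')) ∧ not s'
    shape refl refl refl refl = refl
    irreflexive-clean : ∀ x y → (adj B x y ∨ false) ∧ not (eqᵇ x y) ≡ adj B x y
    irreflexive-clean x y rewrite BoolP.∨-identityʳ (adj B x y) with x FinP.≟ y
    ... | yes refl rewrite adj-irr B x = refl
    ... | no _ = BoolP.∧-identityʳ (adj B x y)

  completeNbhd-⊕ : ∀ a b → adj (completeNbhd G v ⊕ B) a b ≡ adj (completeNbhd (G ⊕ B) v') a b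
  completeNbhd-⊕ a b with side (n G) (n B) a | side (n G) (n B) b
  ... | left x  | left y  = ≡.trans (adj-ll G' B x y)
        (≡.sym (shape (adj-ll G B x y) (adj-ll G B x v) (adj-ll G B y v) (eqᵇ-l x y)))
  ... | right x | right y = ≡.trans (adj-rr G' B x y)
        (≡.sym (≡.trans (shape (adj-rr G B x y) (adj-rl G B x v) (adj-rl G B y v) (eqᵇ-r x y)) (irreflexive-clean x y)))
  ... | left x  | right y = ≡.trans (adj-lr G' B x y)
        (≡.sym (≡.trans (shape (adj-lr G B x y) (adj-ll G B x v) (adj-rl G B y v) (eqᵇ-lr {n G} {n B} x y))
                        (cong (λ z → (false ∨ z) ∧ true) (BoolP.∧-zeroʳ (adj G x v)))))
  ... | right x | left y  = ≡.trans (adj-rl G' B x y)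
        (≡.sym (shape (adj-rl G B x y) (adj-rl G B x v) refl (eqᵇ-rl {n G} {n B} x y)))

iso-by-count : ∀ (G H : Graph) (eq : n G ≡ n H) →
  (∀ i j → adj H (subst Fin eq i) (subst Fin eq j) ≡ adj G i j) → G ≅ H
iso-by-count G H eq pres = record
  { bij = mk↔ₛ′ (subst Fin eq) (subst Fin (≡.sym eq)) (λ _ → subst-subst-sym eq) (λ _ → subst-sym-subst eq)
  ; preserve = pres }

iso-null : ∀ G → n G ≡ 0 → G ≅ nullGraph
iso-null G eq = iso-by-count G nullGraph eq (λ i → ⊥-elim (no-vertex (subst Fin eq i)))
  where no-vertex : Fin 0 → ⊥
        no-vertex ()

iso-E₁ : ∀ G → n G ≡ 1 → G ≅ E₁
iso-E₁ G eq = iso-by-count G E₁ eq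
  (λ i j → subst (λ z → false ≡ adj G i z) (subst-injective {P = Fin} eq (unique _ _)) (≡.sym (adj-irr G i)))
  where unique : (x y : Fin 1) → x ≡ y
        unique zero zero = refl

iso-null-⊕ : ∀ G → (nullGraph ⊕ G) ≅ G
iso-null-⊕ G = iso-by-count (nullGraph ⊕ G) G refl (λ _ _ → refl)

K₂ : Graph
K₂ = record { n = 2 ; adj = λ i j → not (eqᵇ i j)
            ; adj-sym = λ i j → cong not (eqᵇ-sym i j) ; adj-irr = λ i → cong not (eqᵇ-refl i) }

E₂ : Graph
E₂ = E₁ ⊕ E₁

path3 : Fin 3 → Fin 3 → Bool
path3 zero (suc zero)             = true
path3 (suc zero) zero             = true
path3 (suc zero) (suc (suc zero)) = true
path3 (suc (suc zero)) (suc zero) = true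
path3 _ _                         = false

P₃ : Graph
P₃ = record { n = 3 ; adj = path3 ; adj-sym = sym₃ ; adj-irr = irr₃ }
  where
  sym₃ : ∀ i j → path3 i j ≡ path3 j i
  sym₃ zero zero = refl
  sym₃ zero (suc zero) = refl
  sym₃ zero (suc (suc zero)) = refl
  sym₃ (suc zero) zero = refl
  sym₃ (suc zero) (suc zero) = refl
  sym₃ (suc zero) (suc (suc zero)) = refl
  sym₃ (suc (suc zero)) zero = refl
  sym₃ (suc (suc zero)) (suc zero) = refl
  sym₃ (suc (suc zero)) (suc (suc zero)) = refl
  irr₃ : ∀ i → path3 i i ≡ false
  irr₃ zero = refl
  irr₃ (suc zero) = refl
  irr₃ (suc (suc zero)) = refl

by-cases₂ : ∀ {P : Fin 2 → Fin 2 → Set} →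
  P zero zero → P zero (suc zero) → P (suc zero) zero → P (suc zero) (suc zero) → ∀ i j → P i j
by-cases₂ p00 p01 p10 p11 zero       zero       = p00
by-cases₂ p00 p01 p10 p11 zero       (suc zero) = p01
by-cases₂ p00 p01 p10 p11 (suc zero) zero       = p10
by-cases₂ p00 p01 p10 p11 (suc zero) (suc zero) = p11

P₃-delete-end : delete P₃ zero ≅ K₂
P₃-delete-end = iso-by-count _ K₂ refl (by-cases₂ refl refl refl refl)

P₃-contract-end : contract P₃ zero ≅ K₂
P₃-contract-end = iso-by-count _ K₂ refl (by-cases₂ refl refl refl refl)

P₃-delete-middle : delete P₃ (suc zero) ≅ E₂
P₃-delete-middle = iso-by-count _ E₂ refl (by-cases₂ refl refl refl refl)

P₃-contract-middle : contract P₃ (suc zero) ≅ K₂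
P₃-contract-middle = iso-by-count _ K₂ refl (by-cases₂ refl refl refl refl)

module Algebraic {c ℓ : Level} (F : Field c ℓ) where
  open Field F hiding (zero) renaming (refl to ≈-refl)
  open FieldOps F
  open import Relation.Binary.Reasoning.Setoid setoid
  open import Algebra.Solver.Ring.NaturalCoefficients.Default commutativeSemiring
    using (solve; _:+_; _:*_; _:=_; con)
  open import Algebra.Properties.Ring ring using (x[y-z]≈xy-xz)
  open import Algebra.Properties.Group +-group using (x∙y⁻¹≈ε⇒x≈y; ∙-cancelˡ)
  open import Algebra.Properties.CommutativeSemigroup +-commutativeSemigroup using (interchange)

  fixes-nonzero⇒one : ∀ x d → ¬ d ≈ 0# → x * d ≈ d → x ≈ 1#
  fixes-nonzero⇒one x d d≉0 xd≈d = begin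
    x                      ≈⟨ *-identityʳ x ⟨
    x * 1#                 ≈⟨ *-congˡ (inv-r d d≉0) ⟨
    x * (d * inv d d≉0)    ≈⟨ *-assoc x d _ ⟨
    (x * d) * inv d d≉0    ≈⟨ *-congʳ xd≈d ⟩
    d * inv d d≉0          ≈⟨ inv-r d d≉0 ⟩
    1#                     ∎

  no-zero-divisors : ∀ x y → ¬ x ≈ 0# → ¬ y ≈ 0# → ¬ x * y ≈ 0#
  no-zero-divisors x y x≉0 y≉0 xy≈0 = y≉0 (begin
    y                      ≈⟨ *-identityˡ y ⟨
    1# * y                 ≈⟨ *-congʳ (inv-r x x≉0) ⟨
    (x * inv x x≉0) * y    ≈⟨ *-congʳ (*-comm x _) ⟩
    (inv x x≉0 * x) * y    ≈⟨ *-assoc _ x y ⟩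
    inv x x≉0 * (x * y)    ≈⟨ *-congˡ xy≈0 ⟩
    inv x x≉0 * 0#         ≈⟨ zeroʳ _ ⟩
    0#                     ∎)

  difference-nonzero : ∀ x y → ¬ x ≈ y → ¬ x - y ≈ 0#
  difference-nonzero x y x≉y h = x≉y (x∙y⁻¹≈ε⇒x≈y x y h)

  difference-cong : ∀ a b c d → a + d ≈ c + b → a - b ≈ c - d
  difference-cong a b c d h = ∙-cancelˡ (b + d) (a - b) (c - d) (begin
    (b + d) + (a - b)    ≈⟨ solve 4 (λ a b d nb → (b :+ d) :+ (a :+ nb) := (a :+ d) :+ (b :+ nb)) ≈-refl a b d (- b) ⟩
    (a + d) + (b - b)    ≈⟨ +-cong h (-‿inverseʳ b) ⟩
    (c + b) + 0#         ≈⟨ +-cong (+-comm b c) (-‿inverseʳ d) ⟨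
    (b + c) + (d - d)    ≈⟨ solve 4 (λ b c d nd → (b :+ c) :+ (d :+ nd) := (b :+ d) :+ (c :+ nd)) ≈-refl b c d (- d) ⟩
    (b + d) + (c - d)    ∎)

  pow-+ : ∀ x m k → pow x (m ℕ.+ k) ≈ pow x m * pow x k
  pow-+ x zero    k = sym (*-identityˡ _)
  pow-+ x (suc m) k = trans (*-congˡ (pow-+ x m k)) (sym (*-assoc _ _ _))

  pow-* : ∀ x y k → pow (x * y) k ≈ pow x k * pow y k
  pow-* x y zero    = sym (*-identityˡ 1#)
  pow-* x y (suc k) = trans (*-congˡ (pow-* x y k))
    (solve 4 (λ a b p q → (a :* b) :* (p :* q) := (a :* p) :* (b :* q)) ≈-refl x y (pow x k) (pow y k))

  pow-cong : ∀ {x y} k → x ≈ y → pow x k ≈ pow y k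
  pow-cong zero    h = ≈-refl
  pow-cong (suc k) h = *-cong h (pow-cong k h)

  pow-split : ∀ x s k → k ≤ s → pow x s ≈ pow x (s ∸ k) * pow x k
  pow-split x s k k≤s = trans (reflexive (cong (pow x) (≡.sym (ℕP.m∸n+n≡m k≤s)))) (pow-+ x (s ∸ k) k)

  sumOver : ∀ {a} {A : Set a} → List A → (A → Carrier) → Carrier
  sumOver L f = sumF (map f L)

  module _ {a} {A : Set a} where
    sum-cong : ∀ (L : List A) {f g : A → Carrier} → (∀ x → f x ≈ g x) → sumOver L f ≈ sumOver L g
    sum-cong []      h = ≈-refl
    sum-cong (x ∷ L) h = +-cong (h x) (sum-cong L h)

    sum-++ : ∀ (L M : List A) (f : A → Carrier) → sumOver (L ++ M) f ≈ sumOver L f + sumOver M f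
    sum-++ []      M f = sym (+-identityˡ _)
    sum-++ (x ∷ L) M f = trans (+-congˡ (sum-++ L M f)) (sym (+-assoc _ _ _))

    sum-+ : ∀ (L : List A) (f g : A → Carrier) → sumOver L (λ x → f x + g x) ≈ sumOver L f + sumOver L g
    sum-+ []      f g = sym (+-identityˡ _)
    sum-+ (x ∷ L) f g = trans (+-congˡ (sum-+ L f g)) (interchange (f x) (g x) _ _)

    sum-*ˡ : ∀ (L : List A) (k : Carrier) (f : A → Carrier) → sumOver L (λ x → k * f x) ≈ k * sumOver L f
    sum-*ˡ []      k f = sym (zeroʳ k)
    sum-*ˡ (x ∷ L) k f = trans (+-congˡ (sum-*ˡ L k f)) (sym (distribˡ k _ _))

    sum-zero : ∀ (L : List A) (f : A → Carrier) → (∀ x → f x ≈ 0#) → sumOver L f ≈ 0#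
    sum-zero []      f h = ≈-refl
    sum-zero (x ∷ L) f h = trans (+-cong (h x) (sum-zero L f h)) (+-identityˡ 0#)

  sum-map : ∀ {a b} {A : Set a} {B : Set b} (L : List B) (g : B → A) (f : A → Carrier) →
            sumOver (map g L) f ≈ sumOver L (f ∘ g)
  sum-map L g f = reflexive (cong sumF (≡.sym (ListP.map-∘ L)))

  sum-swap : ∀ {a b} {A : Set a} {B : Set b} (L : List A) (M : List B) (h : A → B → Carrier) →
             sumOver L (λ x → sumOver M (h x)) ≈ sumOver M (λ y → sumOver L (λ x → h x y))
  sum-swap []      M h = sym (sum-zero M _ (λ _ → ≈-refl))
  sum-swap (x ∷ L) M h = trans (+-congˡ (sum-swap L M h)) (sym (sum-+ M (h x) _))

  Σ⊆ : ∀ {m} → (Subset m → Carrier) → Carrier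
  Σ⊆ {m} = sumOver (subsets m)

  -- summands depending only on the subset, not on how it is computed
  Respects≗ : ∀ {m} → (Subset m → Carrier) → Set _
  Respects≗ f = ∀ {X Y} → X ≗ˢ Y → f X ≈ f Y

  extend : ∀ {m} → Bool → Subset m → Subset (suc m)
  extend b S zero    = b
  extend b S (suc i) = S i

  sum-split₀ : ∀ {m} (h : Subset (suc m) → Carrier) → Respects≗ h →
               Σ⊆ h ≈ Σ⊆ (h ∘ extend false) + Σ⊆ (h ∘ extend true)
  sum-split₀ {m} h resp = trans (sum-++ (map _ (subsets m)) (map _ (subsets m)) h)
    (+-cong (trans (sum-map (subsets m) _ h) (sum-cong (subsets m) (λ S → resp (λ { zero → refl ; (suc i) → refl }))))
            (trans (sum-map (subsets m) _ h) (sum-cong (subsets m) (λ S → resp (λ { zero → refl ; (suc i) → refl })))))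

  sameᵇ : Bool → Bool → Bool
  sameᵇ true  true  = true
  sameᵇ false false = true
  sameᵇ _     _     = false

  sameᵇ-true : ∀ {x y} → sameᵇ x y ≡ true → x ≡ y
  sameᵇ-true {true}  {true}  _ = refl
  sameᵇ-true {false} {false} _ = refl

  sameᵇ-refl : ∀ x → sameᵇ x x ≡ true
  sameᵇ-refl true  = refl
  sameᵇ-refl false = refl

  _=ˢ_ : ∀ {m} → Subset m → Subset m → Bool
  X =ˢ Y = allᶠ (λ i → sameᵇ (X i) (Y i))

  =ˢ-sound : ∀ {m} {X Y : Subset m} → (X =ˢ Y) ≡ true → X ≗ˢ Y
  =ˢ-sound h i = sameᵇ-true (allᶠ-elim _ h i)

  =ˢ-complete : ∀ {m} {X Y : Subset m} → X ≗ˢ Y → (X =ˢ Y) ≡ true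
  =ˢ-complete {X = X} h = allᶠ-intro _ (λ i → subst (λ z → sameᵇ (X i) z ≡ true) (h i) (sameᵇ-refl (X i)))

  [_]_ : ∀ {m} → (Subset m → Bool) → (Subset m → Carrier) → Subset m → Carrier
  ([ P ] f) X = if P X then f X else 0#

  sum-delta : ∀ {m} (h : Subset m → Carrier) → Respects≗ h → ∀ S → Σ⊆ ([ _=ˢ S ] h) ≈ h S
  sum-delta {zero}  h resp S = trans (+-identityʳ _) (resp (λ ()))
  sum-delta {suc m} h resp S = trans (sum-split₀ _ resp-δ) (by-first (S zero) refl)
    where
    resp-δ : Respects≗ ([ _=ˢ S ] h)
    resp-δ {X} {Y} eq rewrite allᶠ-cong {P = λ i → sameᵇ (X i) (S i)} {Q = λ i → sameᵇ (Y i) (S i)} (λ i → cong (λ z → sameᵇ z (S i)) (eq i))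
      with Y =ˢ S
    ... | true  = resp eq
    ... | false = ≈-refl
    -- only the half of the subsets agreeing with S at 0 contributes
    choose : Bool → Bool → Subset m → Carrier
    choose b b' X = if sameᵇ b' b then ([ _=ˢ (S ∘ suc) ] (h ∘ extend b')) X else 0#
    both : ∀ b → Σ⊆ (choose b false) + Σ⊆ (choose b true) ≈ Σ⊆ ([ _=ˢ (S ∘ suc) ] (h ∘ extend b))
    both false = trans (+-congˡ (sum-zero (subsets m) _ (λ _ → ≈-refl))) (+-identityʳ _)
    both true  = trans (+-congʳ (sum-zero (subsets m) _ (λ _ → ≈-refl))) (+-identityˡ _)
    by-first : ∀ b → S zero ≡ b → Σ⊆ (([ _=ˢ S ] h) ∘ extend false) + Σ⊆ (([ _=ˢ S ] h) ∘ extend true) ≈ h S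
    by-first b s₀ = begin
      Σ⊆ (([ _=ˢ S ] h) ∘ extend false) + Σ⊆ (([ _=ˢ S ] h) ∘ extend true)
        ≈⟨ +-cong (sum-cong (subsets m) (part false)) (sum-cong (subsets m) (part true)) ⟩
      Σ⊆ (choose b false) + Σ⊆ (choose b true)
        ≈⟨ both b ⟩
      Σ⊆ ([ _=ˢ (S ∘ suc) ] (h ∘ extend b))
        ≈⟨ sum-delta (h ∘ extend b) (λ eq → resp (λ { zero → refl ; (suc i) → eq i })) (S ∘ suc) ⟩
      h (extend b (S ∘ suc))
        ≈⟨ resp (λ { zero → ≡.sym s₀ ; (suc i) → refl }) ⟩
      h S ∎
      where
      part : ∀ b' X → ([ _=ˢ S ] h) (extend b' X) ≈ choose b b' X
      part b' X rewrite s₀ with sameᵇ b' b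
      ... | true  = ≈-refl
      ... | false = ≈-refl

  record SubsetBijection (m k : ℕ) (P : Subset k → Bool) : Set where
    field
      to        : Subset m → Subset k
      from      : Subset k → Subset m
      to-resp   : ∀ {Y Y'} → Y ≗ˢ Y' → to Y ≗ˢ to Y'
      from-resp : ∀ {X X'} → X ≗ˢ X' → from X ≗ˢ from X'
      P-resp    : ∀ {X X'} → X ≗ˢ X' → P X ≡ P X'
      to-P      : ∀ Y → P (to Y) ≡ true
      from-to   : ∀ Y → from (to Y) ≗ˢ Y
      to-from   : ∀ X → P X ≡ true → to (from X) ≗ˢ X

  sum-bijection : ∀ {m k P} (B : SubsetBijection m k P) (f : Subset m → Carrier) (g : Subset k → Carrier) →
    Respects≗ f → Respects≗ g → (∀ Y → f Y ≈ g (SubsetBijection.to B Y)) → Σ⊆ f ≈ Σ⊆ ([ P ] g)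
  sum-bijection {m} {k} {P} B f g resp-f resp-g f≈g∘to = begin
    Σ⊆ f                                       ≈⟨ sum-cong (subsets m) (λ Y → sym (sum-delta (λ _ → f Y) (λ _ → ≈-refl) (to Y))) ⟩
    Σ⊆ (λ Y → Σ⊆ (λ X → if X =ˢ to Y then f Y else 0#)) ≈⟨ sum-swap (subsets m) (subsets k) _ ⟩
    Σ⊆ (λ X → Σ⊆ (λ Y → if X =ˢ to Y then f Y else 0#)) ≈⟨ sum-cong (subsets k) fibre ⟩
    Σ⊆ ([ P ] g)                               ∎
    where
    open SubsetBijection B
    ≗-trans : ∀ {j} {A B C : Subset j} → A ≗ˢ B → B ≗ˢ C → A ≗ˢ C
    ≗-trans p q i = ≡.trans (p i) (q i)
    ≗-sym : ∀ {j} {A B : Subset j} → A ≗ˢ B → B ≗ˢ A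
    ≗-sym p i = ≡.sym (p i)
    -- the fibre of X: the unique Y with to Y = X if X ∈ P, nothing otherwise
    fibre : ∀ X → Σ⊆ (λ Y → if X =ˢ to Y then f Y else 0#) ≈ ([ P ] g) X
    fibre X with P X in pX
    ... | true = begin
      Σ⊆ (λ Y → if X =ˢ to Y then f Y else 0#) ≈⟨ sum-cong (subsets m) (λ Y → reflexive (cong (λ z → if z then f Y else 0#) (swap Y))) ⟩
      Σ⊆ ([ _=ˢ from X ] f)                       ≈⟨ sum-delta f resp-f (from X) ⟩
      f (from X)                                  ≈⟨ f≈g∘to (from X) ⟩
      g (to (from X))                             ≈⟨ resp-g (to-from X pX) ⟩
      g X                                         ∎
      where
      swap : ∀ Y → (X =ˢ to Y) ≡ (Y =ˢ from X)
      swap Y = bool-ext (λ h → =ˢ-complete (≗-trans (≗-sym (from-to Y)) (from-resp (≗-sym (=ˢ-sound h)))))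
                        (λ h → =ˢ-complete (≗-trans (≗-sym (to-from X pX)) (to-resp (≗-sym (=ˢ-sound h)))))
    ... | false = sum-zero (subsets m) _ empty
      where
      empty : ∀ Y → (if X =ˢ to Y then f Y else 0#) ≈ 0#
      empty Y with X =ˢ to Y in e
      ... | false = ≈-refl
      ... | true with ≡.trans (≡.sym pX) (≡.trans (P-resp (=ˢ-sound e)) (to-P Y))
      ... | ()

  monomial : Carrier → Carrier → ℕ → ℕ → Carrier
  monomial b c s k = pow c (s ∸ k) * pow (b + c) k

  weight : Carrier → Carrier → (G : Graph) → Subset (n G) → Carrier
  weight b c G X = monomial b c (size X) (components (induced G X))

  U : Carrier → Carrier → Graph → Carrier
  U b c G = Σ⊆ (weight b c G)

  _⊆ᵇ_ : ∀ {m} → Subset m → Subset m → Bool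
  Z ⊆ᵇ X = allᶠ (λ a → not (Z a) ∨ X a)

  module _ (b c : Carrier) where
    weight-resp : ∀ G → Respects≗ (weight b c G)
    weight-resp G {X} {Y} eq = reflexive (cong₂ (monomial b c)
      (≡.trans (size≡count X) (≡.trans (count-cong eq) (≡.sym (size≡count Y))))
      (components-embedding (embedding-resp (induced-embedding G X) eq)))

    U-embedding : ∀ {H G X} → Embedding H G X → U b c H ≈ Σ⊆ ([ _⊆ᵇ X ] (weight b c G))
    U-embedding {H} {G} {X} E = sum-bijection bij (weight b c H) (weight b c G)
        (weight-resp H) (weight-resp G) weight-image
      where
      open Embedding E
      bij : SubsetBijection (n H) (n G) (_⊆ᵇ X)
      bij = record
        { to = image e
        ; from = λ Z → Z ∘ e
        ; to-resp = λ eq a → anyᶠ-cong (λ i → cong (_∧ eqᵇ (e i) a) (eq i))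
        ; from-resp = λ eq i → eq (e i)
        ; P-resp = λ eq → allᶠ-cong (λ a → cong (λ z → not z ∨ X a) (eq a))
        ; to-P = λ Y → allᶠ-intro _ λ a → image-⊆ Y a (image e Y a) refl
        ; from-to = λ Y i → bool-ext (pull Y i) (image-member e Y i)
        ; to-from = λ Z Z⊆X a → bool-ext (push Z a) (back Z Z⊆X a) }
        where
        image-⊆ : ∀ Y a t → image e Y a ≡ t → not t ∨ X a ≡ true
        image-⊆ Y a false _ = refl
        image-⊆ Y a true  h with image-preimage e Y a h
        ... | i , _ , refl = inside i
        pull : ∀ Y i → image e Y (e i) ≡ true → Y i ≡ true
        pull Y i h with image-preimage e Y (e i) h
        ... | j , yj , ej = subst (λ z → Y z ≡ true) (inj ej) yj
        push : ∀ Z a → image e (Z ∘ e) a ≡ true → Z a ≡ true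
        push Z a h with image-preimage e (Z ∘ e) a h
        ... | j , zj , refl = zj
        back : ∀ Z → (Z ⊆ᵇ X) ≡ true → ∀ a → Z a ≡ true → image e (Z ∘ e) a ≡ true
        back Z Z⊆X a za with onto a (in-X (allᶠ-elim _ Z⊆X a))
          where
          in-X : not (Z a) ∨ X a ≡ true → X a ≡ true
          in-X h rewrite za = h
        ... | i , refl = image-member e (Z ∘ e) i za
      weight-image : ∀ Y → weight b c H Y ≈ weight b c G (image e Y)
      weight-image Y = reflexive (cong₂ (monomial b c)
        (≡.trans (EmbeddingWalks.size-embedding (embedding-induced E Y)) (≡.sym (size≡count (image e Y))))
        (components-embedding (embedding-induced E Y)))

    U-same-set : ∀ {H H' A X X'} → Embedding H A X → Embedding H' A X' → X ≗ˢ X' → U b c H ≈ U b c H'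
    U-same-set {A = A} E E' eq = trans (U-embedding E) (trans (sum-cong (subsets (n A)) (λ Z →
      reflexive (cong (λ t → if t then weight b c A Z else 0#) (allᶠ-cong (λ a → cong (not (Z a) ∨_) (eq a))))))
      (sym (U-embedding E')))

    U-onto : ∀ {H A} → Embedding H A full → U b c H ≈ U b c A
    U-onto {A = A} E = trans (U-embedding E) (sum-cong (subsets (n A)) λ Z →
      reflexive (cong (λ t → if t then weight b c A Z else 0#) (allᶠ-intro _ (λ a → BoolP.∨-zeroʳ (not (Z a))))))

    U-invariant : IsGraphInvariant F (U b c)
    U-invariant G H iso = U-onto (embedding-iso iso)

  module Recurrence (b c : Carrier) (G : Graph) (v : Fin (n G)) where
    open LocalComponents G v

    D D' : Subset (n G)
    D u  = not (eqᵇ u v)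
    D' u = not (eqᵇ u v ∨ adj G u v)

    t t' : Subset (n G) → Carrier
    t  = weight b c G
    t' = weight b c G'

    toggle : Subset (n G) → Subset (n G)
    toggle Y a = if eqᵇ a v then not (Y a) else Y a

    toggle-v : ∀ Y → toggle Y v ≡ not (Y v)
    toggle-v Y rewrite eqᵇ-refl v = refl

    toggle-toggle : ∀ Y → toggle (toggle Y) ≗ˢ Y
    toggle-toggle Y a with eqᵇ a v
    ... | true  = BoolP.not-involutive (Y a)
    ... | false = refl

    toggle-resp : ∀ {Y Y'} → Y ≗ˢ Y' → toggle Y ≗ˢ toggle Y'
    toggle-resp eq a rewrite eq a = refl

    toggle-insert : ∀ Y → Y v ≡ false → toggle Y ≗ˢ insert v Y
    toggle-insert Y yv a with decide a v
    ... | inj₁ refl rewrite eqᵇ-refl v | yv = refl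
    ... | inj₂ ne rewrite eqᵇ-false a v ne = ≡.sym (BoolP.∨-identityʳ (Y a))

    ⊆D : ∀ Z → (Z ⊆ᵇ D) ≡ not (Z v)
    ⊆D Z = bool-ext into from
      where
      into : (Z ⊆ᵇ D) ≡ true → not (Z v) ≡ true
      into h with allᶠ-elim _ h v
      ... | q rewrite eqᵇ-refl v = ≡.trans (≡.sym (BoolP.∨-identityʳ (not (Z v)))) q
      from : not (Z v) ≡ true → (Z ⊆ᵇ D) ≡ true
      from h = allᶠ-intro _ pointwise
        where
        pointwise : ∀ a → not (Z a) ∨ D a ≡ true
        pointwise a with decide a v
        ... | inj₁ refl rewrite h = refl
        ... | inj₂ ne rewrite eqᵇ-false a v ne = BoolP.∨-zeroʳ (not (Z a))

    ⊆D'-v : ∀ Z → Z v ≡ true → (Z ⊆ᵇ D') ≡ false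
    ⊆D'-v Z zv with Z ⊆ᵇ D' in e
    ... | false = refl
    ... | true with allᶠ-elim _ e v
    ... | q rewrite zv | eqᵇ-refl v = ≡.sym q

    ⊆D'-away : ∀ Y → (Y ⊆ᵇ D') ≡ true → ∀ a → Y a ≡ true → adj G a v ≡ false
    ⊆D'-away Y h a ya with allᶠ-elim _ h a
    ... | q rewrite ya with adj G a v
    ... | false = refl
    ... | true rewrite BoolP.∨-zeroʳ (eqᵇ a v) = ≡.sym q

    ⊈D'-neighbour : ∀ Y → Y v ≡ false → (Y ⊆ᵇ D') ≡ false → Σ (Fin (n G)) λ w → (Y w ≡ true) × (adj G w v ≡ true)
    ⊈D'-neighbour Y yv h with allᶠ-counterexample _ h
    ... | a , q with Y a in ya
    ... | false with q
    ...   | ()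
    ⊈D'-neighbour Y yv h | a , q | true with decide a v
    ... | inj₁ refl = ⊥-elim (BoolP.not-¬ ya yv)
    ... | inj₂ ne rewrite eqᵇ-false a v ne with adj G a v in av
    ...   | true  = a , ya , av
    ...   | false with q
    ...     | ()

    t∋v : Subset (n G) → Carrier
    t∋v = [ (λ X → X v) ] t

    t∋v-resp : Respects≗ t∋v
    t∋v-resp {X} {X'} eq rewrite eq v with X' v
    ... | true  = weight-resp b c G eq
    ... | false = ≈-refl

    monomial-new-component : ∀ s k → monomial b c (suc s) (suc k) ≈ (b + c) * monomial b c s k
    monomial-new-component s k = x∙yz≈y∙xz (pow c (s ∸ k)) (b + c) (pow (b + c) k)
      where open import Algebra.Properties.CommutativeSemigroup *-commutativeSemigroup using (x∙yz≈y∙xz)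

    monomial-same-components : ∀ s k → k ≤ s → monomial b c (suc s) k ≈ c * monomial b c s k
    monomial-same-components s k k≤s rewrite ℕP.+-∸-assoc 1 k≤s = *-assoc c _ _

    -- Adding v to a set Y ⊆ V - v either creates a new component
    -- (Y ⊆ V - N[v]) or joins v to a component of G'[Y].
    add-v : ∀ Y → t∋v (toggle Y) ≈ b * ([ _⊆ᵇ D' ] t) Y + c * ([ _⊆ᵇ D ] t') Y
    add-v Y rewrite toggle-v Y | ⊆D Y with Y v in yv
    ... | true rewrite ⊆D'-v Y yv = sym (trans (+-cong (zeroʳ b) (zeroʳ c)) (+-identityʳ 0#))
    ... | false with Y ⊆ᵇ D' in sd
    ... | true = begin
      t (toggle Y)                                              ≈⟨ weight-resp b c G (toggle-insert Y yv) ⟩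
      t (insert v Y)                                            ≡⟨ cong₂ (monomial b c) (size-insert Y yv) (Isolated.components-insert Y yv away) ⟩
      monomial b c (suc (size Y)) (suc (components (induced G Y))) ≈⟨ monomial-new-component (size Y) (components (induced G Y)) ⟩
      (b + c) * t Y                                             ≈⟨ distribʳ _ _ _ ⟩
      b * t Y + c * t Y                                         ≈⟨ +-congˡ (*-congˡ (reflexive (cong (monomial b c (size Y)) (≡.sym (Isolated.components-completeNbhd Y yv away))))) ⟩
      b * t Y + c * t' Y                                        ∎
      where away = ⊆D'-away Y sd
    ... | false with ⊈D'-neighbour Y yv sd
    ... | w , yw , wv = begin
      t (toggle Y)                                              ≈⟨ weight-resp b c G (toggle-insert Y yv) ⟩
      t (insert v Y)                                            ≡⟨ cong₂ (monomial b c) (size-insert Y yv) (Attached.components-insert Y yv w yw wv) ⟩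
      monomial b c (suc (size Y)) (components (induced G' Y))   ≈⟨ monomial-same-components (size Y) _ (components-≤ (induced G' Y)) ⟩
      c * t' Y                                                  ≈⟨ +-identityˡ _ ⟨
      0# + c * t' Y                                             ≈⟨ +-congʳ (zeroʳ b) ⟨
      b * 0# + c * t' Y                                         ∎

    toggling : SubsetBijection (n G) (n G) (λ _ → true)
    toggling = record
      { to = toggle ; from = toggle ; to-resp = toggle-resp ; from-resp = toggle-resp
      ; P-resp = λ _ → refl ; to-P = λ _ → refl ; from-to = toggle-toggle ; to-from = λ X _ → toggle-toggle X }

    split-v : ∀ Z → t Z ≈ ([ _⊆ᵇ D ] t) Z + t∋v Z
    split-v Z rewrite ⊆D Z with Z v
    ... | true  = sym (+-identityˡ _)
    ... | false = sym (+-identityʳ _)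

    recurrence : U b c G ≈ 1# * U b c (delete G v) + b * U b c (deleteN G v) + c * U b c (contract G v)
    recurrence = begin
      Σ⊆ t                                                  ≈⟨ sum-cong (subsets (n G)) split-v ⟩
      Σ⊆ (λ Z → ([ _⊆ᵇ D ] t) Z + t∋v Z)                    ≈⟨ sum-+ (subsets (n G)) _ _ ⟩
      Σ⊆ ([ _⊆ᵇ D ] t) + Σ⊆ t∋v                             ≈⟨ +-congˡ (sum-bijection toggling (t∋v ∘ toggle) t∋v (t∋v-resp ∘ toggle-resp) t∋v-resp (λ _ → ≈-refl)) ⟨
      Σ⊆ ([ _⊆ᵇ D ] t) + Σ⊆ (t∋v ∘ toggle)                  ≈⟨ +-congˡ (sum-cong (subsets (n G)) add-v) ⟩
      Σ⊆ ([ _⊆ᵇ D ] t) + Σ⊆ (λ Y → b * ([ _⊆ᵇ D' ] t) Y + c * ([ _⊆ᵇ D ] t') Y)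
        ≈⟨ +-congˡ (trans (sum-+ (subsets (n G)) _ _) (+-cong (sum-*ˡ (subsets (n G)) b _) (sum-*ˡ (subsets (n G)) c _))) ⟩
      Σ⊆ ([ _⊆ᵇ D ] t) + (b * Σ⊆ ([ _⊆ᵇ D' ] t) + c * Σ⊆ ([ _⊆ᵇ D ] t'))
        ≈⟨ +-cong (U-embedding b c (induced-embedding G D))
                  (+-cong (*-congˡ (U-embedding b c (induced-embedding G D'))) (*-congˡ (U-embedding b c (induced-embedding G' D)))) ⟨
      U b c (delete G v) + (b * U b c (deleteN G v) + c * U b c (contract G v))
        ≈⟨ solve 5 (λ x p y q r → x :+ (p :* y :+ q :* r) := con 1 :* x :+ p :* y :+ q :* r) ≈-refl _ b _ c _ ⟩
      1# * U b c (delete G v) + b * U b c (deleteN G v) + c * U b c (contract G v) ∎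

  Recurrent : Carrier → Carrier → Carrier → (Graph → Carrier) → Set _
  Recurrent α β γ f = ∀ G (v : Fin (n G)) → f G ≈ α * f (delete G v) + β * f (deleteN G v) + γ * f (contract G v)

  recurrence-determines : ∀ {α β γ} (f g : Graph → Carrier) → Recurrent α β γ f → Recurrent α β γ g →
                          (∀ G → n G ≡ 0 → f G ≈ g G) → ∀ G → f G ≈ g G
  recurrence-determines {α} {β} {γ} f g rec-f rec-g base G = by-size (n G) G ℕP.≤-refl
    where
    by-size : ∀ k G → n G ≤ k → f G ≈ g G
    by-size k G n≤k with empty-or-vertex G
    ... | inj₁ empty = base G empty
    ... | inj₂ v with k
    ...   | zero   = ⊥-elim (no-vertex (subst Fin (ℕP.n≤0⇒n≡0 n≤k) v))
      where no-vertex : Fin 0 → ⊥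
            no-vertex ()
    ...   | suc k' = begin
      f G                                                             ≈⟨ rec-f G v ⟩
      α * f (delete G v) + β * f (deleteN G v) + γ * f (contract G v) ≈⟨ +-cong (+-cong (*-congˡ (by-size k' _ delete-≤))
                                                                                         (*-congˡ (by-size k' _ (ℕP.≤-trans (deleteN-size G v) delete-≤))))
                                                                                 (*-congˡ (by-size k' _ contract-≤)) ⟩
      α * g (delete G v) + β * g (deleteN G v) + γ * g (contract G v) ≈⟨ rec-g G v ⟨
      g G                                                             ∎
      where
      one-less : ∀ m → suc m ≡ n G → m ≤ k'
      one-less m eq = ℕP.≤-pred (subst (_≤ suc k') (≡.sym eq) n≤k)
      delete-≤   = one-less _ (delete-size G v)
      contract-≤ = one-less _ (contract-size G v)

  recurrent-scale : ∀ {α β γ f} k → Recurrent α β γ f → Recurrent α β γ (λ G → f G * k)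
  recurrent-scale {α} {β} {γ} {f} k rec G v = trans (*-congʳ (rec G v))
    (solve 7 (λ a b g x y z k → (a :* x :+ b :* y :+ g :* z) :* k := a :* (x :* k) :+ b :* (y :* k) :+ g :* (z :* k))
           ≈-refl α β γ (f (delete G v)) (f (deleteN G v)) (f (contract G v)) k)

  module _ (b c : Carrier) where
    U-null : U b c nullGraph ≈ 1#
    U-null = trans (+-identityʳ _) (*-identityˡ 1#)

    U-empty : ∀ G → n G ≡ 0 → U b c G ≈ 1#
    U-empty G empty = trans (U-invariant b c G nullGraph (iso-null G empty)) U-null

    U-E₁ : U b c E₁ ≈ 1# + b + c
    U-E₁ = solve 2 (λ x y → con 1 :* con 1 :+ (con 1 :* ((x :+ y) :* con 1) :+ con 0) := con 1 :+ x :+ y) ≈-refl b c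

    U-recurrent : Recurrent 1# b c (U b c)
    U-recurrent = Recurrence.recurrence b c

    -- G ↦ U(G ⊕ B) satisfies the recurrence, since deleting or contracting
    -- a vertex of G commutes with adding B
    U-⊕-recurrent : ∀ B → Recurrent 1# b c (λ G → U b c (G ⊕ B))
    U-⊕-recurrent B G v = begin
      U b c (G ⊕ B)
        ≈⟨ U-recurrent (G ⊕ B) v' ⟩
      1# * U b c (delete (G ⊕ B) v') + b * U b c (deleteN (G ⊕ B) v') + c * U b c (contract (G ⊕ B) v')
        ≈⟨ +-cong (+-cong (*-congˡ (U-same-set b c (induced-embedding (G ⊕ B) _) (embedding-⊕ (induced-embedding G _) B) delete-set))
                          (*-congˡ (U-same-set b c (induced-embedding (G ⊕ B) _) (embedding-⊕ (induced-embedding G _) B) deleteN-set)))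
                  (*-congˡ (U-same-set b c (induced-embedding (completeNbhd (G ⊕ B) v') _) contract↪ delete-set)) ⟩
      1# * U b c (delete G v ⊕ B) + b * U b c (deleteN G v ⊕ B) + c * U b c (contract G v ⊕ B) ∎
      where
      open DeleteInSum G B v
      E = embedding-⊕ (induced-embedding (completeNbhd G v) (λ u → not (eqᵇ u v))) B
      contract↪ : Embedding (contract G v ⊕ B) (completeNbhd (G ⊕ B) v') (withRight G B (λ u → not (eqᵇ u v)))
      contract↪ = record
        { e = Embedding.e E ; inj = Embedding.inj E
        ; adj-e = λ i j → ≡.trans (Embedding.adj-e E i j) (completeNbhd-⊕ _ _)
        ; inside = Embedding.inside E ; onto = Embedding.onto E }

    U-multiplicative : ∀ A B → U b c (A ⊕ B) ≈ U b c A * U b c B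
    U-multiplicative A B = recurrence-determines (λ G → U b c (G ⊕ B)) (λ G → U b c G * U b c B)
      (U-⊕-recurrent B) (recurrent-scale (U b c B) U-recurrent) empty-left A
      where
      empty-left : ∀ G → n G ≡ 0 → U b c (G ⊕ B) ≈ U b c G * U b c B
      empty-left G empty = begin
        U b c (G ⊕ B)       ≈⟨ U-onto b c (embedding-right G B empty) ⟨
        U b c B             ≈⟨ *-identityˡ _ ⟨
        1# * U b c B        ≈⟨ *-congʳ (U-empty G empty) ⟨
        U b c G * U b c B   ∎

    U-well-defined : WellDefinedBy F 1# b c 1# (1# + b + c) (U b c)
    U-well-defined = U-multiplicative , U-recurrent , U-null , U-E₁

  -- U(·; 1, 0) separates E₂ (value 4) from K₂ (value 3)
  U-proper : IsProper F (U 1# 0#)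
  U-proper = E₂ , K₂ , refl , four≉three
    where
    two = 1# + 1# + 0#
    U-E₂ : U 1# 0# E₂ ≈ two * two
    U-E₂ = trans (U-multiplicative 1# 0# E₁ E₁) (*-cong (U-E₁ 1# 0#) (U-E₁ 1# 0#))
    U-K₂ : U 1# 0# K₂ ≈ 1# * two + 1# * 1# + 0# * two
    U-K₂ = trans (U-recurrent 1# 0# K₂ zero)
      (+-cong (+-cong (*-congˡ (trans (U-invariant 1# 0# (delete K₂ zero) E₁ (iso-E₁ _ refl)) (U-E₁ 1# 0#)))
                      (*-congˡ (U-empty 1# 0# (deleteN K₂ zero) refl)))
              (*-congˡ (trans (U-invariant 1# 0# (contract K₂ zero) E₁ (iso-E₁ _ refl)) (U-E₁ 1# 0#))))
    four≉three : ¬ U 1# 0# E₂ ≈ U 1# 0# K₂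
    four≉three h = 1≉0 (∙-cancelˡ (1# + 1# + 1#) 1# 0# (begin
      (1# + 1# + 1#) + 1#               ≈⟨ solve 0 (con 3 :+ con 1 := (con 1 :+ con 1 :+ con 0) :* (con 1 :+ con 1 :+ con 0)) ≈-refl ⟩
      two * two                         ≈⟨ trans (sym U-E₂) (trans h U-K₂) ⟩
      1# * two + 1# * 1# + 0# * two     ≈⟨ solve 0 (con 1 :* (con 1 :+ con 1 :+ con 0) :+ con 1 :* con 1 :+ con 0 :* (con 1 :+ con 1 :+ con 0) := con 3 :+ con 0) ≈-refl ⟩
      (1# + 1# + 1#) + 0#               ∎))

  module Constraints (α β γ δ ε : Carrier) (f : Graph → Carrier) (invariant : IsGraphInvariant F f)
                     (proper : IsProper F f) (well-defined : WellDefinedBy F α β γ δ ε f) where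
    private
      multiplicative = proj₁ well-defined
      recurrent      = proj₁ (proj₂ well-defined)
      f-null         = proj₁ (proj₂ (proj₂ well-defined))
      f-E₁           = proj₂ (proj₂ (proj₂ well-defined))
      G₁ = proj₁ proper
      G₂ = proj₁ (proj₂ proper)
      same-size = proj₁ (proj₂ (proj₂ proper))
      separated = proj₂ (proj₂ (proj₂ proper))

    -- f is determined by the recurrence and its value on the null graph,
    -- so it cannot agree with another recurrent invariant that is constant
    -- on graphs of equal size
    not-a-function-of-size : ∀ (g : Graph → Carrier) → Recurrent α β γ g → (∀ G → n G ≡ 0 → f G ≈ g G) →
                          (∀ G H → n G ≡ n H → g G ≈ g H) → ⊥
    not-a-function-of-size g rec-g base by-size = separated (begin
      f G₁ ≈⟨ f≈g G₁ ⟩ g G₁ ≈⟨ by-size G₁ G₂ same-size ⟩ g G₂ ≈⟨ f≈g G₂ ⟨ f G₂ ∎)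
      where f≈g = recurrence-determines f g recurrent rec-g base

    -- (c): f(∅ ⊕ G) = δ f(G), and f separates two graphs
    δ≈1 : δ ≈ 1#
    δ≈1 = fixes-nonzero⇒one δ (f G₁ - f G₂) (difference-nonzero _ _ separated) (begin
      δ * (f G₁ - f G₂)           ≈⟨ x[y-z]≈xy-xz δ (f G₁) (f G₂) ⟩
      δ * f G₁ - δ * f G₂         ≈⟨ +-cong (sym (scaled G₁)) (-‿cong (sym (scaled G₂))) ⟩
      f G₁ - f G₂                 ∎)
      where
      scaled : ∀ G → f G ≈ δ * f G
      scaled G = trans (sym (invariant _ _ (iso-null-⊕ G))) (trans (multiplicative nullGraph G) (*-congʳ f-null))

    f-empty : ∀ G → n G ≡ 0 → f G ≈ 1#
    f-empty G empty = trans (invariant G nullGraph (iso-null G empty)) (trans f-null δ≈1)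

    f-single : ∀ G → n G ≡ 1 → f G ≈ ε
    f-single G single = trans (invariant G E₁ (iso-E₁ G single)) f-E₁

    ε≈α+β+γ : ε ≈ α + β + γ
    ε≈α+β+γ = begin
      ε                                                                   ≈⟨ f-E₁ ⟨
      f E₁                                                                ≈⟨ recurrent E₁ zero ⟩
      α * f (delete E₁ zero) + β * f (deleteN E₁ zero) + γ * f (contract E₁ zero)
        ≈⟨ +-cong (+-cong (*-congˡ (f-empty _ refl)) (*-congˡ (f-empty _ refl))) (*-congˡ (f-empty _ refl)) ⟩
      α * 1# + β * 1# + γ * 1#                                            ≈⟨ solve 3 (λ a b g → a :* con 1 :+ b :* con 1 :+ g :* con 1 := a :+ b :+ g) ≈-refl α β γ ⟩
      α + β + γ                                                           ∎

    -- if ε = 1 then f is constantly 1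
    ε≉1 : ¬ ε ≈ 1#
    ε≉1 ε≈1 = not-a-function-of-size (λ _ → 1#) constant (λ G empty → f-empty G empty) (λ _ _ _ → ≈-refl)
      where
      constant : Recurrent α β γ (λ _ → 1#)
      constant _ _ = sym (begin
        α * 1# + β * 1# + γ * 1#  ≈⟨ solve 3 (λ a b g → a :* con 1 :+ b :* con 1 :+ g :* con 1 := a :+ b :+ g) ≈-refl α β γ ⟩
        α + β + γ                 ≈⟨ ε≈α+β+γ ⟨
        ε                         ≈⟨ ε≈1 ⟩
        1#                        ∎)

    -- if β = 0 then f(G) = ε^|V(G)|
    β≉0 : ¬ β ≈ 0#
    β≉0 β≈0 = not-a-function-of-size (λ G → pow ε (n G)) power (λ G empty → trans (f-empty G empty) (reflexive (cong (pow ε) (≡.sym empty))))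
                (λ G H eq → reflexive (cong (pow ε) eq))
      where
      power : Recurrent α β γ (λ G → pow ε (n G))
      power G v = begin
        pow ε (n G)                   ≡⟨ cong (pow ε) (≡.sym (delete-size G v)) ⟩
        ε * pow ε (n (delete G v))    ≈⟨ *-congʳ (trans ε≈α+β+γ (+-congʳ (+-congˡ β≈0))) ⟩
        (α + 0# + γ) * pow ε (n (delete G v))
          ≈⟨ solve 4 (λ a g x y → (a :+ con 0 :+ g) :* x := a :* x :+ con 0 :* y :+ g :* x) ≈-refl α γ (pow ε (n (delete G v))) (pow ε (n (deleteN G v))) ⟩
        α * pow ε (n (delete G v)) + 0# * pow ε (n (deleteN G v)) + γ * pow ε (n (delete G v))
          ≈⟨ +-cong (+-congˡ (*-congʳ (sym β≈0))) (*-congˡ (reflexive (cong (pow ε) same-count))) ⟩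
        α * pow ε (n (delete G v)) + β * pow ε (n (deleteN G v)) + γ * pow ε (n (contract G v)) ∎
        where
        same-count : n (delete G v) ≡ n (contract G v)
        same-count = ℕP.suc-injective (≡.trans (delete-size G v) (≡.sym (contract-size G v)))

    f-K₂ : f K₂ ≈ α * ε + β * 1# + γ * ε
    f-K₂ = trans (recurrent K₂ zero) (+-cong (+-cong (*-congˡ (f-single _ refl)) (*-congˡ (f-empty _ refl))) (*-congˡ (f-single _ refl)))

    P₃-at-end : f P₃ ≈ α * f K₂ + β * ε + γ * f K₂
    P₃-at-end = trans (recurrent P₃ zero)
      (+-cong (+-cong (*-congˡ (invariant _ _ P₃-delete-end)) (*-congˡ (f-single _ refl))) (*-congˡ (invariant _ _ P₃-contract-end)))

    P₃-at-middle : f P₃ ≈ α * (ε * ε) + β * 1# + γ * f K₂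
    P₃-at-middle = trans (recurrent P₃ (suc zero))
      (+-cong (+-cong (*-congˡ (trans (invariant _ _ P₃-delete-middle) (trans (multiplicative E₁ E₁) (*-cong f-E₁ f-E₁))))
                      (*-congˡ (f-empty _ refl)))
              (*-congˡ (invariant _ _ P₃-contract-middle)))

    P₃-identity : α * β + β * (α + β + γ) ≈ α * β * (α + β + γ) + β
    P₃-identity = ∙-cancelˡ (α * ((α + γ) * E)) _ _ (begin
      α * ((α + γ) * E) + (α * β + β * E)   ≈⟨ solve 3 (λ a b g → a :* ((a :+ g) :* (a :+ b :+ g)) :+ (a :* b :+ b :* (a :+ b :+ g))
                                                          := a :* (a :* (a :+ b :+ g) :+ b :* con 1 :+ g :* (a :+ b :+ g)) :+ b :* (a :+ b :+ g)) ≈-refl α β γ ⟩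
      α * K + β * E                         ≈⟨ +-cong (*-congˡ K≈f-K₂) (*-congˡ (sym ε≈α+β+γ)) ⟩
      α * f K₂ + β * ε                      ≈⟨ ∙-cancelʳ (γ * f K₂) _ _ (trans (sym P₃-at-end) P₃-at-middle) ⟩
      α * (ε * ε) + β * 1#                  ≈⟨ +-congʳ (*-congˡ (*-cong ε≈α+β+γ ε≈α+β+γ)) ⟩
      α * (E * E) + β * 1#                  ≈⟨ solve 3 (λ a b g → a :* ((a :+ b :+ g) :* (a :+ b :+ g)) :+ b :* con 1
                                                          := a :* ((a :+ g) :* (a :+ b :+ g)) :+ (a :* b :* (a :+ b :+ g) :+ b)) ≈-refl α β γ ⟩
      α * ((α + γ) * E) + (α * β * E + β)   ∎)
      where
      E = α + β + γ
      K = α * E + β * 1# + γ * E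
      open import Algebra.Properties.Group +-group using (∙-cancelʳ)
      K≈f-K₂ : K ≈ f K₂
      K≈f-K₂ = sym (trans f-K₂ (+-cong (+-congʳ (*-congˡ ε≈α+β+γ)) (*-congˡ ε≈α+β+γ)))

    α≈1 : α ≈ 1#
    α≈1 = fixes-nonzero⇒one α w w≉0 (begin
      α * (β * (E - 1#))           ≈⟨ *-assoc α β _ ⟨
      (α * β) * (E - 1#)           ≈⟨ x[y-z]≈xy-xz (α * β) E 1# ⟩
      α * β * E - α * β * 1#       ≈⟨ difference-cong _ _ _ _ rearranged ⟩
      β * E - β * 1#               ≈⟨ x[y-z]≈xy-xz β E 1# ⟨
      β * (E - 1#)                 ∎)
      where
      E = α + β + γ
      w = β * (E - 1#)
      w≉0 : ¬ w ≈ 0#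
      w≉0 = no-zero-divisors β (E - 1#) β≉0 (difference-nonzero E 1# (λ E≈1 → ε≉1 (trans ε≈α+β+γ E≈1)))
      rearranged : α * β * E + β * 1# ≈ β * E + α * β * 1#
      rearranged = begin
        α * β * E + β * 1#    ≈⟨ +-congˡ (*-identityʳ β) ⟩
        α * β * E + β         ≈⟨ P₃-identity ⟨
        α * β + β * E         ≈⟨ +-comm _ _ ⟩
        β * E + α * β         ≈⟨ +-congˡ (*-identityʳ (α * β)) ⟨
        β * E + α * β * 1#    ∎

    parameters : (α ≈ 1#) × (δ ≈ 1#) × (ε ≈ 1# + β + γ)
    parameters = α≈1 , δ≈1 , trans ε≈α+β+γ (+-congʳ (+-congʳ α≈1))

  U-unique : ∀ (α b c δ ε : Carrier) (g : Graph → Carrier) →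
             IsGraphInvariant F g → IsProper F g → WellDefinedBy F α b c δ ε g → ∀ G → g G ≈ U b c G
  U-unique α b c δ ε g invariant proper well-defined =
    recurrence-determines g (U b c) recurrent-α=1 (U-recurrent b c)
      (λ G empty → trans (f-empty G empty) (sym (U-empty b c G empty)))
    where
    open Constraints α b c δ ε g invariant proper well-defined using (α≈1; f-empty)
    recurrent-α=1 : Recurrent 1# b c g
    recurrent-α=1 G v = trans (proj₁ (proj₂ well-defined) G v) (+-congʳ (+-congʳ (*-congʳ α≈1)))

  -- termwise: x^|X| y^k = x^{|X|-k} (x(y-1) + x)^k
  Q≈U : ∀ x y G → Q F G x y ≈ U (x * (y - 1#)) x G
  Q≈U x y G = sum-cong (subsets (n G)) termwise
    where
    termwise : ∀ X → pow x (size X) * pow y (components (induced G X)) ≈ weight (x * (y - 1#)) x G X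
    termwise X = begin
      pow x s * pow y k                          ≈⟨ *-congʳ (pow-split x s k (components-≤ (induced G X))) ⟩
      (pow x (s ∸ k) * pow x k) * pow y k        ≈⟨ *-assoc _ _ _ ⟩
      pow x (s ∸ k) * (pow x k * pow y k)        ≈⟨ *-congˡ (pow-* x y k) ⟨
      pow x (s ∸ k) * pow (x * y) k              ≈⟨ *-congˡ (pow-cong k xy≈) ⟩
      pow x (s ∸ k) * pow (x * (y - 1#) + x) k   ∎
      where
      s = size X
      k = components (induced G X)
      xy≈ : x * y ≈ x * (y - 1#) + x
      xy≈ = begin
        x * y                    ≈⟨ *-congˡ (+-identityʳ y) ⟨
        x * (y + 0#)             ≈⟨ *-congˡ (+-congˡ (-‿inverseˡ 1#)) ⟨
        x * (y + (- 1# + 1#))    ≈⟨ *-congˡ (+-assoc y (- 1#) 1#) ⟨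
        x * ((y - 1#) + 1#)      ≈⟨ distribˡ x (y - 1#) 1# ⟩
        x * (y - 1#) + x * 1#    ≈⟨ +-congˡ (*-identityʳ x) ⟩
        x * (y - 1#) + x         ∎

  -- termwise: c^{|X|-k} (b + c)^k = c^|X| (b/c + 1)^k
  U≈Q : ∀ b c (c≉0 : ¬ (c ≈ 0#)) G → U b c G ≈ Q F G c (b * inv c c≉0 + 1#)
  U≈Q b c c≉0 G = sum-cong (subsets (n G)) termwise
    where
    c⁻¹ = inv c c≉0
    b+c≈ : b + c ≈ c * (b * c⁻¹ + 1#)
    b+c≈ = begin
      b + c                  ≈⟨ +-congʳ (trans (sym (*-identityʳ b)) (*-congˡ (sym (inv-r c c≉0)))) ⟩
      b * (c * c⁻¹) + c      ≈⟨ solve 3 (λ b c i → b :* (c :* i) :+ c := c :* (b :* i :+ con 1)) ≈-refl b c c⁻¹ ⟩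
      c * (b * c⁻¹ + 1#)     ∎
    termwise : ∀ X → weight b c G X ≈ pow c (size X) * pow (b * c⁻¹ + 1#) (components (induced G X))
    termwise X = begin
      pow c (s ∸ k) * pow (b + c) k                      ≈⟨ *-congˡ (pow-cong k b+c≈) ⟩
      pow c (s ∸ k) * pow (c * (b * c⁻¹ + 1#)) k         ≈⟨ *-congˡ (pow-* c _ k) ⟩
      pow c (s ∸ k) * (pow c k * pow (b * c⁻¹ + 1#) k)   ≈⟨ *-assoc _ _ _ ⟨
      (pow c (s ∸ k) * pow c k) * pow (b * c⁻¹ + 1#) k   ≈⟨ *-congʳ (pow-split c s k (components-≤ (induced G X))) ⟨
      pow c s * pow (b * c⁻¹ + 1#) k                     ∎
      where
      s = size X
      k = components (induced G X)

theorem5p10 : ∀ {c ℓ : Level} (F : Field c ℓ) → CharZero F →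
  let open Field F in
  -- (1)
  (∀ (α β γ δ ε : Carrier) (f : Graph → Carrier) →
     IsGraphInvariant F f → IsProper F f → WellDefinedBy F α β γ δ ε f →
     (α ≈ 1#) × (δ ≈ 1#) × (ε ≈ 1# + β + γ))
  ×
  -- (2)
  Σ (Carrier → Carrier → Graph → Carrier) (λ U →
      (∀ b c → IsGraphInvariant F (U b c) × WellDefinedBy F 1# b c 1# (1# + b + c) (U b c))
    × Σ Carrier (λ b → Σ Carrier (λ c → IsProper F (U b c)))
    × (∀ (α b c δ ε : Carrier) (g : Graph → Carrier) →
         IsGraphInvariant F g → IsProper F g → WellDefinedBy F α b c δ ε g →
         ∀ G → g G ≈ U b c G)
    × (∀ x y G → Q F G x y ≈ U (x * (y - 1#)) x G)
    × (∀ b c (p : ¬ (c ≈ 0#)) → ∀ G → U b c G ≈ Q F G c (b * inv c p + 1#)))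
theorem5p10 F _ =
    (λ α β γ δ ε f invariant proper well-defined → Constraints.parameters α β γ δ ε f invariant proper well-defined)
  , U
  , (λ b c → U-invariant b c , U-well-defined b c)
  , (1# , 0# , U-proper)
  , U-unique
  , Q≈U
  , U≈Q
  where
  open Field F using (1#; 0#)
  open Algebraic F
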